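{- In the cell-probe model with any word size $w$ and an alphabet whose size is polynomial in $n$, the online edit distance problem can be solved in $$O\!\left(\frac{\log^2 n}{w}\right)$$ amortised cell probes per output.
   Context: Cell-probe model: memory is an unbounded array of cells of $w$ bits each. The cost of an algorithm is the number of cells it reads or writes (cell probes); all computation is free. The algorithm may process the fixed string $F$ in a preprocessing phase before the first stream symbol arrives; the stated bound counts the cell probes performed while processing the stream, amortised over the arrivals. Online edit distance problem: a fixed string $F$ of length $n$ is given, and stream symbols $S[0],S[1],\dots$ arrive one at a time. $\mathrm{Edit}(A,B)$ is the minimum number of single-symbol replacements, deletions and insertions needed to transform $A$ into $B$. Immediately after $S[i]$ arrives, the algorithm outputs $\min_{h\le i}\mathrm{Edit}(F,S[h,i])$, where $S[h,i]$ denotes $S[h]S[h+1]\cdots S[i]$. -}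

module Defs where

open import Data.Nat using (ℕ; zero; suc; _+_; _*_; _^_; _≤_; _≟_)
open import Data.Fin using (Fin)
open import Data.List using (List; []; _∷_; _++_; [_]; map)
open import Data.Vec using (Vec; toList)
open import Data.Product using (_×_; _,_; proj₁; proj₂; ∃-syntax)
open import Data.Sum using (_⊎_)
open import Relation.Binary.PropositionalEquality using (_≡_)
open import Relation.Nullary using (does)
open import Data.Bool using (if_then_else_)

data OneEdit {A : Set} : List A → List A → Set where
  replace : (u v : List A) (x y : A) → OneEdit (u ++ x ∷ v) (u ++ y ∷ v)
  delete  : (u v : List A) (x : A)   → OneEdit (u ++ x ∷ v) (u ++ v)
  insert  : (u v : List A) (y : A)   → OneEdit (u ++ v) (u ++ y ∷ v)

data EditsIn {A : Set} : List A → List A → ℕ → Set where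
  done : ∀ {X} → EditsIn X X 0
  step : ∀ {X Y Z k} → OneEdit X Y → EditsIn Y Z k → EditsIn X Z (suc k)


segFrom : {A : Set} → (ℕ → A) → ℕ → ℕ → List A
segFrom S h zero    = [ S h ]
segFrom S h (suc l) = S h ∷ segFrom S (suc h) l

-- segment of length suc l starting at h: S[h, h+l]
-- IsOnlineAnswer F S i d : d = min_{h ≤ i} Edit(F, S[h,i])
IsOnlineAnswer : {A : Set} → List A → (ℕ → A) → ℕ → ℕ → Set
IsOnlineAnswer F S i d =
    (∃[ h ] ∃[ l ] (h + l ≡ i × IsEditUB h l))
  × (∀ h l k → h + l ≡ i → EditsIn F (segFrom S h l) k → d ≤ k)
  where
  IsEditUB : ℕ → ℕ → Set
  IsEditUB h l = EditsIn F (segFrom S h l) d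

Word : ℕ → Set
Word w = Fin (2 ^ w)

Memory : ℕ → Set
Memory w = ℕ → Word w

-- A cell-probe program: an adaptive decision tree of reads and writes;
-- all computation between probes is free.
data Prog (w : ℕ) (R : Set) : Set where
  ret   : R → Prog w R
  read  : ℕ → (Word w → Prog w R) → Prog w R
  write : ℕ → Word w → Prog w R → Prog w R

update : ∀ w → Memory w → ℕ → Word w → Memory w
update w m j v k = if does (k ≟ j) then v else m k

exec : ∀ {w R} → Prog w R → Memory w → R × Memory w × ℕ
exec (ret r) m = r , m , 0
exec (read j k) m with exec (k (m j)) m
... | r , m' , c = r , m' , suc c
exec {w} (write j v p) m with exec p (update w m j v)
... | r , m' , c = r , m' , suc c

-- An online algorithm over alphabet Fin σ: an initial memory (the result
-- of the free preprocessing of F) and, for each arriving symbol, a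
-- cell-probe program producing the output.
record OnlineAlg (w σ : ℕ) : Set where
  field
    initMem : Memory w
    onSymbol : Fin σ → Prog w ℕ
open OnlineAlg public

module _ {w σ : ℕ} (Alg : OnlineAlg w σ) (S : ℕ → Fin σ) where
  memBefore : ℕ → Memory w
  memBefore zero    = initMem Alg
  memBefore (suc i) = proj₁ (proj₂ (exec (onSymbol Alg (S i)) (memBefore i)))

  output : ℕ → ℕ
  output i = proj₁ (exec (onSymbol Alg (S i)) (memBefore i))

  probesAt : ℕ → ℕ
  probesAt i = proj₂ (proj₂ (exec (onSymbol Alg (S i)) (memBefore i)))

  totalProbes : ℕ → ℕ
  totalProbes zero    = 0
  totalProbes (suc t) = totalProbes t + probesAt t

{-# OPTIONS --safe #-}

-- The algorithm maintains columns of the edit-distance dynamic program (E j is the cheapest way to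
-- turn F[0, j) into a suffix of the stream), advances them by whole blocks of symbols at a time,
-- and reads the answer off the current column.  A column that only has to serve K more symbols can be
-- compressed to 2K + 1 numbers ≤ n, since entries more than 2K above the cheapest way to finish
-- cannot win within K symbols.  Level k ≤ T = ⌈log₂ n⌉ keeps a column valid for 2^k symbols,
-- refreshed from level k + 1 once every 2^k steps by a binary counter.  A carry up to level k
-- costs O(2^k log n / w + k) probes (symbols also take O(log n) bits, as σ ≤ d nᶜ), so a step
-- costs Σ_k O(log n / w + k / 2^k) = O(log² n / w + 1) amortised probes.

module Submission where

open import Data.Bool using (Bool; true; false; if_then_else_)
open import Data.Fin using (Fin; fromℕ<; toℕ)
open import Data.Fin.Properties using (toℕ-fromℕ<; toℕ<n; toℕ-injective)
open import Data.List using (List; []; [_]; _++_; _∷_; drop; length; map; replicate; take)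
open import Data.List.Properties
  using (++-assoc; ++-identityʳ; drop-all; drop-drop; length-++; length-drop; length-map; length-replicate; length-take; take++drop≡id)
open import Data.List.Relation.Unary.All using (All; []; _∷_)
open import Data.Nat
open import Data.Nat.DivMod
open import Data.Nat.Divisibility using (n∣m*n)
open import Data.Nat.Induction using (<-wellFounded)
open import Data.Nat.Logarithm using (⌈log₂_⌉)
open import Data.Nat.Logarithm.Core using (⌈log2⌉)
open import Data.Nat.Properties
open import Data.Nat.Tactic.RingSolver using (solve-∀)
open import Data.Product using (_,_; _×_; proj₁; proj₂; Σ-syntax; ∃-syntax)
open import Data.Sum using (_⊎_; inj₁; inj₂)
open import Data.Unit using (⊤; tt)
open import Data.Vec using (Vec; []; toList)
open import Data.Vec.Properties using (length-toList)
open import Function.Definitions using (Injective)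
open import Induction.WellFounded using (Acc; acc)
open import Relation.Binary.Definitions using (DecidableEquality; tri<; tri≈; tri>)
open import Relation.Binary.PropositionalEquality hiding ([_])
open import Relation.Nullary using (Dec; does; yes; no; ¬_; contradiction)
open import Relation.Nullary.Decidable using (dec-true; dec-false; map′)

open import Defs

-- Edit distance

m⊓n⊓o≤m : ∀ m n o → m ⊓ n ⊓ o ≤ m
m⊓n⊓o≤m m n o = ≤-trans (m⊓n≤m (m ⊓ n) o) (m⊓n≤m m n)

m⊓n⊓o≤n : ∀ m n o → m ⊓ n ⊓ o ≤ n
m⊓n⊓o≤n m n o = ≤-trans (m⊓n≤m (m ⊓ n) o) (m⊓n≤n m n)

m⊓n⊓o≤o : ∀ m n o → m ⊓ n ⊓ o ≤ o
m⊓n⊓o≤o m n o = m⊓n≤n (m ⊓ n) o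

⊓₃-elim : ∀ (P : ℕ → Set) m n o → P m → P n → P o → P (m ⊓ n ⊓ o)
⊓₃-elim P m n o pm pn po with ⊓-sel (m ⊓ n) o | ⊓-sel m n
... | inj₂ e | _       = subst P (sym e) po
... | inj₁ e | inj₁ e′ = subst P (sym (trans e e′)) pm
... | inj₁ e | inj₂ e′ = subst P (sym (trans e e′)) pn

module EditDistance {A : Set} (_≟_ : DecidableEquality A) where

  mismatch : A → A → ℕ
  mismatch a b = if does (a ≟ b) then 0 else 1

  mismatch≤1 : ∀ a b → mismatch a b ≤ 1
  mismatch≤1 a b with does (a ≟ b)
  ... | true  = z≤n
  ... | false = ≤-refl

  mismatch-refl : ∀ a → mismatch a a ≡ 0
  mismatch-refl a = cong (if_then 0 else 1) (dec-true (a ≟ a) refl)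

  mismatch-≢ : ∀ {a b} → a ≢ b → mismatch a b ≡ 1
  mismatch-≢ {a} {b} a≢b = cong (if_then 0 else 1) (dec-false (a ≟ b) a≢b)

  mismatch-sym : ∀ a b → mismatch a b ≡ mismatch b a
  mismatch-sym a b with a ≟ b
  ... | yes refl = sym (mismatch-refl a)
  ... | no a≢b   = sym (mismatch-≢ (λ b≡a → a≢b (sym b≡a)))

  ed : List A → List A → ℕ
  ed []       ys       = length ys
  ed (x ∷ xs) []       = suc (length xs)
  ed (x ∷ xs) (y ∷ ys) = (ed xs ys + mismatch x y) ⊓ suc (ed xs (y ∷ ys)) ⊓ suc (ed (x ∷ xs) ys)

  ed-[]ʳ : ∀ xs → ed xs [] ≡ length xs
  ed-[]ʳ []       = refl
  ed-[]ʳ (x ∷ xs) = refl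

  ed-∷ˡ : ∀ x xs ys → ed (x ∷ xs) ys ≤ suc (ed xs ys)
  ed-∷ˡ x xs []       = ≤-reflexive (cong suc (sym (ed-[]ʳ xs)))
  ed-∷ˡ x xs (y ∷ ys) = m⊓n⊓o≤n _ _ _

  ed-∷ʳ : ∀ xs y ys → ed xs (y ∷ ys) ≤ suc (ed xs ys)
  ed-∷ʳ []       y ys = ≤-refl
  ed-∷ʳ (x ∷ xs) y ys = m⊓n⊓o≤o _ _ _

  ed-++ˡ : ∀ as xs ys → ed (as ++ xs) ys ≤ length as + ed xs ys
  ed-++ˡ []       xs ys = ≤-refl
  ed-++ˡ (a ∷ as) xs ys = ≤-trans (ed-∷ˡ a (as ++ xs) ys) (s≤s (ed-++ˡ as xs ys))

  ed-++ʳ : ∀ xs bs ys → ed xs (bs ++ ys) ≤ length bs + ed xs ys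
  ed-++ʳ xs []       ys = ≤-refl
  ed-++ʳ xs (b ∷ bs) ys = ≤-trans (ed-∷ʳ xs b (bs ++ ys)) (s≤s (ed-++ʳ xs bs ys))

  ed≤length+length : ∀ xs ys → ed xs ys ≤ length xs + length ys
  ed≤length+length xs ys = subst (λ zs → ed zs ys ≤ length xs + length ys) (++-identityʳ xs) (ed-++ˡ xs [] ys)

  length≤ed+length : ∀ xs ys → length xs ≤ ed xs ys + length ys
  length≤ed+length []       ys       = z≤n
  length≤ed+length (x ∷ xs) []       = ≤-reflexive (sym (+-identityʳ _))
  length≤ed+length (x ∷ xs) (y ∷ ys) =
    ⊓₃-elim (λ e → suc (length xs) ≤ e + suc (length ys)) _ _ _
      (≤-trans (s≤s (length≤ed+length xs ys))
               (≤-trans (≤-reflexive (sym (+-suc (ed xs ys) (length ys)))) (+-monoˡ-≤ (suc (length ys)) (m≤m+n _ _))))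
      (s≤s (length≤ed+length xs (y ∷ ys)))
      (≤-trans (length≤ed+length (x ∷ xs) ys) (+-mono-≤ (n≤1+n _) (n≤1+n _)))

  ed-refl : ∀ xs → ed xs xs ≡ 0
  ed-refl []       = refl
  ed-refl (x ∷ xs) = n≤0⇒n≡0 (≤-trans (m⊓n⊓o≤m _ _ _) (≤-reflexive (cong₂ _+_ (ed-refl xs) (mismatch-refl x))))

  ed-sym : ∀ xs ys → ed xs ys ≡ ed ys xs
  ed-sym []       []       = refl
  ed-sym []       (y ∷ ys) = refl
  ed-sym (x ∷ xs) []       = refl
  ed-sym (x ∷ xs) (y ∷ ys) = begin
    (ed xs ys + mismatch x y) ⊓ suc (ed xs (y ∷ ys)) ⊓ suc (ed (x ∷ xs) ys)
      ≡⟨ cong₂ (λ u v → u ⊓ v) (cong₂ (λ u v → u ⊓ suc v) (cong₂ _+_ (ed-sym xs ys) (mismatch-sym x y)) (ed-sym xs (y ∷ ys)))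
                                (cong suc (ed-sym (x ∷ xs) ys)) ⟩
    (ed ys xs + mismatch y x) ⊓ suc (ed (y ∷ ys) xs) ⊓ suc (ed ys (x ∷ xs))
      ≡⟨ ⊓-assoc _ _ _ ⟩
    (ed ys xs + mismatch y x) ⊓ (suc (ed (y ∷ ys) xs) ⊓ suc (ed ys (x ∷ xs)))
      ≡⟨ cong ((ed ys xs + mismatch y x) ⊓_) (⊓-comm _ _) ⟩
    (ed ys xs + mismatch y x) ⊓ (suc (ed ys (x ∷ xs)) ⊓ suc (ed (y ∷ ys) xs))
      ≡⟨ ⊓-assoc _ _ _ ⟨
    (ed ys xs + mismatch y x) ⊓ suc (ed ys (x ∷ xs)) ⊓ suc (ed (y ∷ ys) xs) ∎
    where open ≡-Reasoning

  ed-++-≤ : ∀ xs xs′ ys ys′ → ed (xs ++ xs′) (ys ++ ys′) ≤ ed xs ys + ed xs′ ys′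
  ed-++-≤ []       xs′ ys       ys′ = ed-++ʳ xs′ ys ys′
  ed-++-≤ (x ∷ xs) xs′ []       ys′ = ed-++ˡ (x ∷ xs) xs′ ys′
  ed-++-≤ (x ∷ xs) xs′ (y ∷ ys) ys′ =
    ⊓₃-elim (λ e → ed (x ∷ xs ++ xs′) (y ∷ ys ++ ys′) ≤ e + ed xs′ ys′) _ _ _
      (begin
        ed (x ∷ xs ++ xs′) (y ∷ ys ++ ys′)         ≤⟨ m⊓n⊓o≤m _ _ _ ⟩
        ed (xs ++ xs′) (ys ++ ys′) + mismatch x y  ≤⟨ +-monoˡ-≤ _ (ed-++-≤ xs xs′ ys ys′) ⟩
        ed xs ys + ed xs′ ys′ + mismatch x y       ≡⟨ +-assoc (ed xs ys) _ _ ⟩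
        ed xs ys + (ed xs′ ys′ + mismatch x y)     ≡⟨ cong (ed xs ys +_) (+-comm _ (mismatch x y)) ⟩
        ed xs ys + (mismatch x y + ed xs′ ys′)     ≡⟨ +-assoc (ed xs ys) _ _ ⟨
        ed xs ys + mismatch x y + ed xs′ ys′       ∎)
      (≤-trans (m⊓n⊓o≤n _ _ _) (s≤s (ed-++-≤ xs xs′ (y ∷ ys) ys′)))
      (≤-trans (m⊓n⊓o≤o _ _ _) (s≤s (ed-++-≤ (x ∷ xs) xs′ ys ys′)))
    where open ≤-Reasoning

  ed-split : ∀ xs ys ys′ → Σ[ k ∈ ℕ ] (k ≤ length xs × ed (take k xs) ys + ed (drop k xs) ys′ ≤ ed xs (ys ++ ys′))
  ed-split xs       []       ys′ = 0 , z≤n , ≤-refl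
  ed-split []       (y ∷ ys) ys′ = 0 , z≤n , ≤-reflexive (cong suc (sym (length-++ ys)))
  ed-split (x ∷ xs) (y ∷ ys) ys′ =
    ⊓₃-elim (λ e → Split (x ∷ xs) (y ∷ ys) e) _ _ _
      (match (ed-split xs ys ys′)) (deleteˡ (ed-split xs (y ∷ ys) ys′)) (insertʳ (ed-split (x ∷ xs) ys ys′))
    where
    open ≤-Reasoning
    Split : List A → List A → ℕ → Set
    Split us vs e = Σ[ k ∈ ℕ ] (k ≤ length us × ed (take k us) vs + ed (drop k us) ys′ ≤ e)
    match : Split xs ys (ed xs (ys ++ ys′)) → Split (x ∷ xs) (y ∷ ys) (ed xs (ys ++ ys′) + mismatch x y)
    match (k , k≤ , h) = suc k , s≤s k≤ , (begin
      ed (x ∷ take k xs) (y ∷ ys) + ed (drop k xs) ys′         ≤⟨ +-monoˡ-≤ (ed (drop k xs) ys′) (m⊓n⊓o≤m _ _ _) ⟩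
      ed (take k xs) ys + mismatch x y + ed (drop k xs) ys′    ≡⟨ +-assoc (ed (take k xs) ys) _ _ ⟩
      ed (take k xs) ys + (mismatch x y + ed (drop k xs) ys′)  ≡⟨ cong (ed (take k xs) ys +_) (+-comm (mismatch x y) _) ⟩
      ed (take k xs) ys + (ed (drop k xs) ys′ + mismatch x y)  ≡⟨ +-assoc (ed (take k xs) ys) _ _ ⟨
      ed (take k xs) ys + ed (drop k xs) ys′ + mismatch x y    ≤⟨ +-monoˡ-≤ _ h ⟩
      ed xs (ys ++ ys′) + mismatch x y                         ∎)
    deleteˡ : Split xs (y ∷ ys) (ed xs (y ∷ ys ++ ys′)) → Split (x ∷ xs) (y ∷ ys) (suc (ed xs (y ∷ ys ++ ys′)))
    deleteˡ (k , k≤ , h) = suc k , s≤s k≤ , ≤-trans (+-monoˡ-≤ (ed (drop k xs) ys′) (m⊓n⊓o≤n _ _ _)) (s≤s h)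
    insertʳ : Split (x ∷ xs) ys (ed (x ∷ xs) (ys ++ ys′)) → Split (x ∷ xs) (y ∷ ys) (suc (ed (x ∷ xs) (ys ++ ys′)))
    insertʳ (k , k≤ , h) = k , k≤ , ≤-trans (+-monoˡ-≤ (ed (drop k (x ∷ xs)) ys′) (ed-∷ʳ (take k (x ∷ xs)) y ys)) (s≤s h)

  ed-singleton : ∀ xs y → 1 ≤ length xs → ed xs [ y ] ≤ length xs
  ed-singleton (x ∷ xs) y _ = ≤-trans (m⊓n⊓o≤m _ _ _)
    (≤-trans (+-mono-≤ (≤-reflexive (ed-[]ʳ xs)) (mismatch≤1 x y)) (≤-reflexive (+-comm (length xs) 1)))

  ed-replace-head : ∀ x y v zs → ed (x ∷ v) zs ≤ suc (ed (y ∷ v) zs)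
  ed-replace-head x y v []       = n≤1+n _
  ed-replace-head x y v (z ∷ zs) =
    ⊓₃-elim (λ e → ed (x ∷ v) (z ∷ zs) ≤ suc e) _ _ _
      (≤-trans (m⊓n⊓o≤m _ _ _)
        (≤-trans (+-monoʳ-≤ (ed v zs) (mismatch≤1 x z))
          (≤-trans (≤-reflexive (+-comm (ed v zs) 1)) (s≤s (m≤m+n _ _)))))
      (≤-trans (m⊓n⊓o≤n _ _ _) (n≤1+n _))
      (≤-trans (m⊓n⊓o≤o _ _ _) (s≤s (ed-replace-head x y v zs)))

  ed-drop-head : ∀ y v zs → ed v zs ≤ suc (ed (y ∷ v) zs)
  ed-drop-head y v []       = ≤-trans (≤-reflexive (ed-[]ʳ v)) (≤-trans (n≤1+n _) (n≤1+n _))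
  ed-drop-head y v (z ∷ zs) =
    ⊓₃-elim (λ e → ed v (z ∷ zs) ≤ suc e) _ _ _
      (≤-trans (ed-∷ʳ v z zs) (s≤s (m≤m+n _ _)))
      (≤-trans (n≤1+n _) (n≤1+n _))
      (≤-trans (ed-∷ʳ v z zs) (s≤s (ed-drop-head y v zs)))

  ed-++-lift : ∀ u v v′ → (∀ zs → ed v zs ≤ suc (ed v′ zs)) → ∀ zs → ed (u ++ v) zs ≤ suc (ed (u ++ v′) zs)
  ed-++-lift u v v′ h zs with ed-split zs u v′
  ... | k , _ , split = begin
    ed (u ++ v) zs                                 ≡⟨ cong (ed (u ++ v)) (take++drop≡id k zs) ⟨
    ed (u ++ v) (take k zs ++ drop k zs)           ≤⟨ ed-++-≤ u v (take k zs) (drop k zs) ⟩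
    ed u (take k zs) + ed v (drop k zs)            ≤⟨ +-monoʳ-≤ (ed u (take k zs)) (h (drop k zs)) ⟩
    ed u (take k zs) + suc (ed v′ (drop k zs))     ≡⟨ +-suc _ _ ⟩
    suc (ed u (take k zs) + ed v′ (drop k zs))     ≡⟨ cong suc (cong₂ _+_ (ed-sym u _) (ed-sym v′ _)) ⟩
    suc (ed (take k zs) u + ed (drop k zs) v′)     ≤⟨ s≤s split ⟩
    suc (ed zs (u ++ v′))                          ≡⟨ cong suc (ed-sym zs (u ++ v′)) ⟩
    suc (ed (u ++ v′) zs)                          ∎
    where open ≤-Reasoning

  ed-OneEdit : ∀ {X Y} → OneEdit X Y → ∀ zs → ed X zs ≤ suc (ed Y zs)
  ed-OneEdit (replace u v x y) = ed-++-lift u (x ∷ v) (y ∷ v) (ed-replace-head x y v)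
  ed-OneEdit (delete u v x)    = ed-++-lift u (x ∷ v) v (ed-∷ˡ x v)
  ed-OneEdit (insert u v y)    = ed-++-lift u v (y ∷ v) (ed-drop-head y v)

  ed≤EditsIn : ∀ {X Z k} → EditsIn X Z k → ed X Z ≤ k
  ed≤EditsIn {X}     done       = ≤-reflexive (ed-refl X)
  ed≤EditsIn {X} {Z} (step e r) = ≤-trans (ed-OneEdit e Z) (s≤s (ed≤EditsIn r))

  EditsIn-∷ : ∀ {X Y : List A} {k} c → EditsIn X Y k → EditsIn (c ∷ X) (c ∷ Y) k
  EditsIn-∷ c done                        = done
  EditsIn-∷ c (step (replace u v x y) r) = step (replace (c ∷ u) v x y) (EditsIn-∷ c r)
  EditsIn-∷ c (step (delete u v x) r)    = step (delete (c ∷ u) v x) (EditsIn-∷ c r)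
  EditsIn-∷ c (step (insert u v y) r)    = step (insert (c ∷ u) v y) (EditsIn-∷ c r)

  EditsIn-ed : ∀ X Z → EditsIn X Z (ed X Z)
  EditsIn-ed []       []       = done
  EditsIn-ed []       (z ∷ zs) = step (insert [] [] z) (EditsIn-∷ z (EditsIn-ed [] zs))
  EditsIn-ed (x ∷ xs) []       =
    subst (EditsIn (x ∷ xs) []) (cong suc (ed-[]ʳ xs)) (step (delete [] xs x) (EditsIn-ed xs []))
  EditsIn-ed (x ∷ xs) (z ∷ zs) =
    ⊓₃-elim (EditsIn (x ∷ xs) (z ∷ zs)) _ _ _
      (match (x ≟ z)) (step (delete [] xs x) (EditsIn-ed xs (z ∷ zs)))
      (step (insert [] (x ∷ xs) z) (EditsIn-∷ z (EditsIn-ed (x ∷ xs) zs)))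
    where
    match : Dec (x ≡ z) → EditsIn (x ∷ xs) (z ∷ zs) (ed xs zs + mismatch x z)
    match (yes refl) = subst (EditsIn (x ∷ xs) (x ∷ zs)) (sym (trans (cong (ed xs zs +_) (mismatch-refl x)) (+-identityʳ _)))
                             (EditsIn-∷ x (EditsIn-ed xs zs))
    match (no x≢z)   = subst (EditsIn (x ∷ xs) (z ∷ zs)) (sym (trans (cong (ed xs zs +_) (mismatch-≢ x≢z)) (+-comm _ 1)))
                             (step (replace [] xs x z) (EditsIn-∷ z (EditsIn-ed xs zs)))

module _ {A B : Set} (_≟A_ : DecidableEquality A) (_≟B_ : DecidableEquality B)
         {f : A → B} (f-injective : Injective _≡_ _≡_ f) where
  private
    module EA = EditDistance _≟A_
    module EB = EditDistance _≟B_

  mismatch-map : ∀ a b → EA.mismatch a b ≡ EB.mismatch (f a) (f b)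
  mismatch-map a b with a ≟A b
  ... | yes refl = sym (EB.mismatch-refl (f a))
  ... | no a≢b   = sym (EB.mismatch-≢ (λ fa≡fb → a≢b (f-injective fa≡fb)))

  ed-map : ∀ xs ys → EA.ed xs ys ≡ EB.ed (map f xs) (map f ys)
  ed-map []       ys       = sym (length-map f ys)
  ed-map (x ∷ xs) []       = cong suc (sym (length-map f xs))
  ed-map (x ∷ xs) (y ∷ ys) =
    cong₂ _⊓_ (cong₂ _⊓_ (cong₂ _+_ (ed-map xs ys) (mismatch-map x y)) (cong suc (ed-map xs (y ∷ ys))))
              (cong suc (ed-map (x ∷ xs) ys))

-- Columns of the dynamic program

minUpTo : (ℕ → ℕ) → ℕ → ℕ
minUpTo f zero    = f 0
minUpTo f (suc m) = minUpTo f m ⊓ f (suc m)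

minUpTo-≤ : ∀ f {m j} → j ≤ m → minUpTo f m ≤ f j
minUpTo-≤ f {zero}  z≤n = ≤-refl
minUpTo-≤ f {suc m} j≤1+m with m≤n⇒m<n∨m≡n j≤1+m
... | inj₁ j<1+m = ≤-trans (m⊓n≤m _ _) (minUpTo-≤ f (s≤s⁻¹ j<1+m))
... | inj₂ refl  = m⊓n≤n _ _

minUpTo-attained : ∀ f m → Σ[ j ∈ ℕ ] (j ≤ m × minUpTo f m ≡ f j)
minUpTo-attained f zero    = 0 , z≤n , refl
minUpTo-attained f (suc m) with ⊓-sel (minUpTo f m) (f (suc m))
... | inj₂ e = suc m , ≤-refl , e
... | inj₁ e with minUpTo-attained f m
...   | j , j≤m , e′ = j , m≤n⇒m≤1+n j≤m , trans e e′

minUpTo-greatest : ∀ f m {a} → (∀ {j} → j ≤ m → a ≤ f j) → a ≤ minUpTo f m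
minUpTo-greatest f zero    h = h z≤n
minUpTo-greatest f (suc m) h = ⊓-glb (minUpTo-greatest f m (λ j≤m → h (m≤n⇒m≤1+n j≤m))) (h ≤-refl)

minUpTo-cong : ∀ {f g} m → (∀ {j} → j ≤ m → f j ≡ g j) → minUpTo f m ≡ minUpTo g m
minUpTo-cong zero    h = h z≤n
minUpTo-cong (suc m) h = cong₂ _⊓_ (minUpTo-cong m (λ j≤m → h (m≤n⇒m≤1+n j≤m))) (h ≤-refl)

minUpTo-antitone : ∀ f {m m′} → m′ ≤ m → minUpTo f m ≤ minUpTo f m′
minUpTo-antitone f {m} {m′} m′≤m = minUpTo-greatest f m′ (λ j≤m′ → minUpTo-≤ f (≤-trans j≤m′ m′≤m))

module _ {A : Set} where

  minSuffix : (List A → ℕ) → List A → ℕ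
  minSuffix g []       = g []
  minSuffix g (x ∷ xs) = g (x ∷ xs) ⊓ minSuffix g xs

  minSuffix-≤ : ∀ g xs k → minSuffix g xs ≤ g (drop k xs)
  minSuffix-≤ g []       zero    = ≤-refl
  minSuffix-≤ g []       (suc k) = ≤-refl
  minSuffix-≤ g (x ∷ xs) zero    = m⊓n≤m _ _
  minSuffix-≤ g (x ∷ xs) (suc k) = ≤-trans (m⊓n≤n _ _) (minSuffix-≤ g xs k)

  minSuffix-attained : ∀ g xs → Σ[ k ∈ ℕ ] (minSuffix g xs ≡ g (drop k xs))
  minSuffix-attained g []       = 0 , refl
  minSuffix-attained g (x ∷ xs) with ⊓-sel (g (x ∷ xs)) (minSuffix g xs)
  ... | inj₁ e = 0 , e
  ... | inj₂ e with minSuffix-attained g xs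
  ...   | k , e′ = suc k , trans e e′

  minSuffix-++-≤ : ∀ g xs ys k → minSuffix g (xs ++ ys) ≤ g (drop k xs ++ ys)
  minSuffix-++-≤ g []       ys zero    = minSuffix-≤ g ys 0
  minSuffix-++-≤ g []       ys (suc k) = minSuffix-≤ g ys 0
  minSuffix-++-≤ g (x ∷ xs) ys zero    = m⊓n≤m _ _
  minSuffix-++-≤ g (x ∷ xs) ys (suc k) = ≤-trans (m⊓n≤n _ _) (minSuffix-++-≤ g xs ys k)

  minSuffix-++ʳ : ∀ g xs ys → minSuffix g (xs ++ ys) ≤ minSuffix g ys
  minSuffix-++ʳ g []       ys = ≤-refl
  minSuffix-++ʳ g (x ∷ xs) ys = ≤-trans (m⊓n≤n _ _) (minSuffix-++ʳ g xs ys)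

  minSuffix-++-greatest : ∀ g xs ys {a} → (∀ k → a ≤ g (drop k xs ++ ys)) → a ≤ minSuffix g ys →
                          a ≤ minSuffix g (xs ++ ys)
  minSuffix-++-greatest g []       ys h h′ = h′
  minSuffix-++-greatest g (x ∷ xs) ys h h′ = ⊓-glb (h 0) (minSuffix-++-greatest g xs ys (λ k → h (suc k)) h′)

module Columns {A : Set} (_≟_ : DecidableEquality A) (F : List A) where
  open EditDistance _≟_

  n : ℕ
  n = length F

  slice : ℕ → ℕ → List A
  slice j′ j = take (j ∸ j′) (drop j′ F)

  length-take-F : ∀ {j} → j ≤ n → length (take j F) ≡ j
  length-take-F {j} j≤n = trans (length-take j F) (m≤n⇒m⊓n≡m j≤n)

  length-slice : ∀ j′ {j} → j ≤ n → length (slice j′ j) ≡ j ∸ j′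
  length-slice j′ {j} j≤n =
    trans (length-take (j ∸ j′) (drop j′ F))
          (trans (cong ((j ∸ j′) ⊓_) (length-drop j′ F)) (m≤n⇒m⊓n≡m (∸-monoˡ-≤ j′ j≤n)))

  drop-slice : ∀ {j′ j} → j′ ≤ j → drop j′ F ≡ slice j′ j ++ drop j F
  drop-slice {j′} {j} j′≤j = begin
    drop j′ F                                                ≡⟨ take++drop≡id (j ∸ j′) (drop j′ F) ⟨
    slice j′ j ++ drop (j ∸ j′) (drop j′ F)                  ≡⟨ cong (slice j′ j ++_) (drop-drop j′ (j ∸ j′) F) ⟩
    slice j′ j ++ drop (j′ + (j ∸ j′)) F                     ≡⟨ cong (λ i → slice j′ j ++ drop i F) (m+[n∸m]≡n j′≤j) ⟩
    slice j′ j ++ drop j F                                   ∎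
    where open ≡-Reasoning

  -- A column E records at E j the cheapest way to turn F[0, j) into a suffix of the stream read so
  -- far; bestMatch E Y is then the cheapest way to turn F into a suffix of that stream followed by Y.
  Column : Set
  Column = ℕ → ℕ

  viaColumn : Column → List A → ℕ
  viaColumn E Y = minUpTo (λ j → E j + ed (drop j F) Y) n

  bestMatch : Column → List A → ℕ
  bestMatch E Y = viaColumn E Y ⊓ minSuffix (ed F) Y

  advance : Column → List A → Column
  advance E X j = minUpTo (λ j′ → E j′ + ed (slice j′ j) X) j ⊓ minSuffix (ed (take j F)) X

  initial : Column
  initial j = j

  viaColumn-≤ : ∀ E Y {j} → j ≤ n → viaColumn E Y ≤ E j + ed (drop j F) Y
  viaColumn-≤ E Y = minUpTo-≤ (λ j → E j + ed (drop j F) Y)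

  advance-≤-column : ∀ E X {j′ j} → j′ ≤ j → advance E X j ≤ E j′ + ed (slice j′ j) X
  advance-≤-column E X {j′} {j} j′≤j = ≤-trans (m⊓n≤m _ _) (minUpTo-≤ (λ j′ → E j′ + ed (slice j′ j) X) j′≤j)

  advance-≤-fresh : ∀ E X j k → advance E X j ≤ ed (take j F) (drop k X)
  advance-≤-fresh E X j k = ≤-trans (m⊓n≤n _ _) (minSuffix-≤ (ed (take j F)) X k)

  bestMatch-advance-≤ : ∀ E X Y → bestMatch (advance E X) Y ≤ bestMatch E (X ++ Y)
  bestMatch-advance-≤ E X Y = ⊓-glb throughColumn throughX
    where
    open ≤-Reasoning
    bestMatch≤ : ∀ {j} → j ≤ n → bestMatch (advance E X) Y ≤ advance E X j + ed (drop j F) Y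
    bestMatch≤ j≤n = ≤-trans (m⊓n≤m _ _) (viaColumn-≤ (advance E X) Y j≤n)
    throughColumn : bestMatch (advance E X) Y ≤ viaColumn E (X ++ Y)
    throughColumn = minUpTo-greatest _ n λ {j′} j′≤n → cut j′≤n (ed-split (drop j′ F) X Y)
      where
      cut : ∀ {j′} → j′ ≤ n →
            Σ[ k ∈ ℕ ] (k ≤ length (drop j′ F) × ed (take k (drop j′ F)) X + ed (drop k (drop j′ F)) Y ≤ ed (drop j′ F) (X ++ Y)) →
            bestMatch (advance E X) Y ≤ E j′ + ed (drop j′ F) (X ++ Y)
      cut {j′} j′≤n (k , k≤ , split) = begin
        bestMatch (advance E X) Y                                    ≤⟨ bestMatch≤ j≤n ⟩
        advance E X j + ed (drop j F) Y                              ≤⟨ +-monoˡ-≤ _ (advance-≤-column E X (m≤m+n j′ k)) ⟩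
        E j′ + ed (slice j′ j) X + ed (drop j F) Y                   ≡⟨ +-assoc (E j′) _ _ ⟩
        E j′ + (ed (slice j′ j) X + ed (drop j F) Y)                 ≡⟨ cong₂ (λ u v → E j′ + (ed u X + ed v Y)) slice≡ drop≡ ⟩
        E j′ + (ed (take k (drop j′ F)) X + ed (drop k (drop j′ F)) Y) ≤⟨ +-monoʳ-≤ (E j′) split ⟩
        E j′ + ed (drop j′ F) (X ++ Y)                               ∎
        where
        j = j′ + k
        j≤n : j ≤ n
        j≤n = ≤-trans (+-monoʳ-≤ j′ (≤-trans k≤ (≤-reflexive (length-drop j′ F)))) (≤-reflexive (m+[n∸m]≡n j′≤n))
        slice≡ : slice j′ j ≡ take k (drop j′ F)
        slice≡ = cong (λ i → take i (drop j′ F)) (m+n∸m≡n j′ k)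
        drop≡ : drop j F ≡ drop k (drop j′ F)
        drop≡ = sym (drop-drop j′ k F)
    throughX : bestMatch (advance E X) Y ≤ minSuffix (ed F) (X ++ Y)
    throughX = minSuffix-++-greatest (ed F) X Y (λ k → cut k (ed-split F (drop k X) Y)) (m⊓n≤n _ _)
      where
      cut : ∀ k → Σ[ j ∈ ℕ ] (j ≤ n × ed (take j F) (drop k X) + ed (drop j F) Y ≤ ed F (drop k X ++ Y)) →
            bestMatch (advance E X) Y ≤ ed F (drop k X ++ Y)
      cut k (j , j≤n , split) = begin
        bestMatch (advance E X) Y                         ≤⟨ bestMatch≤ j≤n ⟩
        advance E X j + ed (drop j F) Y                   ≤⟨ +-monoˡ-≤ _ (advance-≤-fresh E X j k) ⟩
        ed (take j F) (drop k X) + ed (drop j F) Y        ≤⟨ split ⟩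
        ed F (drop k X ++ Y)                              ∎

  bestMatch-advance-≥ : ∀ E X Y → bestMatch E (X ++ Y) ≤ bestMatch (advance E X) Y
  bestMatch-advance-≥ E X Y = ⊓-glb throughColumn (≤-trans (m⊓n≤n _ _) (minSuffix-++ʳ (ed F) X Y))
    where
    open ≤-Reasoning
    fromColumn : ∀ {j} → j ≤ n → bestMatch E (X ++ Y) ≤ minUpTo (λ j′ → E j′ + ed (slice j′ j) X) j + ed (drop j F) Y
    fromColumn {j} j≤n with minUpTo-attained (λ j′ → E j′ + ed (slice j′ j) X) j
    ... | j′ , j′≤j , attained = begin
      bestMatch E (X ++ Y)                                ≤⟨ m⊓n≤m _ _ ⟩
      viaColumn E (X ++ Y)                                ≤⟨ viaColumn-≤ E (X ++ Y) (≤-trans j′≤j j≤n) ⟩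
      E j′ + ed (drop j′ F) (X ++ Y)                      ≡⟨ cong (λ u → E j′ + ed u (X ++ Y)) (drop-slice j′≤j) ⟩
      E j′ + ed (slice j′ j ++ drop j F) (X ++ Y)         ≤⟨ +-monoʳ-≤ (E j′) (ed-++-≤ (slice j′ j) (drop j F) X Y) ⟩
      E j′ + (ed (slice j′ j) X + ed (drop j F) Y)        ≡⟨ +-assoc (E j′) _ _ ⟨
      E j′ + ed (slice j′ j) X + ed (drop j F) Y          ≡⟨ cong (_+ ed (drop j F) Y) attained ⟨
      minUpTo (λ j′ → E j′ + ed (slice j′ j) X) j + ed (drop j F) Y ∎
    fresh : ∀ j → bestMatch E (X ++ Y) ≤ minSuffix (ed (take j F)) X + ed (drop j F) Y
    fresh j with minSuffix-attained (ed (take j F)) X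
    ... | k , attained = begin
      bestMatch E (X ++ Y)                                ≤⟨ m⊓n≤n _ _ ⟩
      minSuffix (ed F) (X ++ Y)                           ≤⟨ minSuffix-++-≤ (ed F) X Y k ⟩
      ed F (drop k X ++ Y)                                ≡⟨ cong (λ u → ed u (drop k X ++ Y)) (take++drop≡id j F) ⟨
      ed (take j F ++ drop j F) (drop k X ++ Y)           ≤⟨ ed-++-≤ (take j F) (drop j F) (drop k X) Y ⟩
      ed (take j F) (drop k X) + ed (drop j F) Y          ≡⟨ cong (_+ ed (drop j F) Y) attained ⟨
      minSuffix (ed (take j F)) X + ed (drop j F) Y       ∎
    throughColumn : bestMatch E (X ++ Y) ≤ viaColumn (advance E X) Y
    throughColumn = minUpTo-greatest _ n λ {j} j≤n →
      ≤-trans (⊓-glb (fromColumn j≤n) (fresh j)) (≤-reflexive (sym (+-distribʳ-⊓ (ed (drop j F) Y) _ _)))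

  bestMatch-advance : ∀ E X Y → bestMatch (advance E X) Y ≡ bestMatch E (X ++ Y)
  bestMatch-advance E X Y = ≤-antisym (bestMatch-advance-≤ E X Y) (bestMatch-advance-≥ E X Y)

  bestMatch-initial : ∀ Y → bestMatch initial Y ≡ minSuffix (ed F) Y
  bestMatch-initial Y = m≥n⇒m⊓n≡n (minUpTo-greatest _ n λ {j} j≤n → begin
    minSuffix (ed F) Y                  ≤⟨ minSuffix-≤ (ed F) Y 0 ⟩
    ed F Y                              ≡⟨ cong (λ u → ed u Y) (take++drop≡id j F) ⟨
    ed (take j F ++ drop j F) Y         ≤⟨ ed-++ˡ (take j F) (drop j F) Y ⟩
    length (take j F) + ed (drop j F) Y ≡⟨ cong (_+ ed (drop j F) Y) (length-take-F j≤n) ⟩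
    j + ed (drop j F) Y                 ∎)
    where open ≤-Reasoning

  advance-at-n : ∀ E X → advance E X n ≤ n
  advance-at-n E X = begin
    advance E X n                       ≤⟨ advance-≤-fresh E X n (length X) ⟩
    ed (take n F) (drop (length X) X)   ≡⟨ cong (ed (take n F)) (drop-all (length X) X ≤-refl) ⟩
    ed (take n F) []                    ≡⟨ ed-[]ʳ (take n F) ⟩
    length (take n F)                   ≡⟨ length-take-F ≤-refl ⟩
    n                                   ∎
    where open ≤-Reasoning

  advance-at-0 : ∀ E X → advance E X 0 ≡ 0
  advance-at-0 E X = n≤0⇒n≡0 (≤-trans (advance-≤-fresh E X 0 (length X)) (≤-reflexive (cong (ed []) (drop-all (length X) X ≤-refl))))

  finishCost : Column → ℕ → ℕ
  finishCost E j = minUpTo (λ j′ → E j′ + (n ∸ j′)) j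

  finishCost-antitone : ∀ E {i j} → i ≤ j → finishCost E j ≤ finishCost E i
  finishCost-antitone E = minUpTo-antitone (λ j′ → E j′ + (n ∸ j′))

  -- (finishCost E j + j) ∸ n = min_{j′ ≤ j} (E j′ + (j ∸ j′)) closes E under insertions, which
  -- changes no alignment cost; capping finishCost 2K above finishCost E n only affects entries
  -- that cannot win within K more symbols.
  compress : ℕ → Column → Column
  compress K E j = (finishCost E j ⊓ (finishCost E n + (K + K)) + j) ∸ n

  compress-≤ : ∀ K E {j} → j ≤ n → compress K E j ≤ E j
  compress-≤ K E {j} j≤n = begin
    (finishCost E j ⊓ (finishCost E n + (K + K)) + j) ∸ n ≤⟨ ∸-monoˡ-≤ n (+-monoˡ-≤ j (≤-trans (m⊓n≤m _ _) (minUpTo-≤ (λ j′ → E j′ + (n ∸ j′)) ≤-refl))) ⟩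
    (E j + (n ∸ j) + j) ∸ n                               ≡⟨ cong (_∸ n) (trans (+-assoc (E j) _ _) (cong (E j +_) (m∸n+n≡m j≤n))) ⟩
    (E j + n) ∸ n                                         ≡⟨ m+n∸n≡m (E j) n ⟩
    E j                                                   ∎
    where open ≤-Reasoning

  viaColumn-≤-finishCost : ∀ E Y → viaColumn E Y ≤ finishCost E n + length Y
  viaColumn-≤-finishCost E Y with minUpTo-attained (λ j′ → E j′ + (n ∸ j′)) n
  ... | j , j≤n , attained = begin
    viaColumn E Y                      ≤⟨ viaColumn-≤ E Y j≤n ⟩
    E j + ed (drop j F) Y              ≤⟨ +-monoʳ-≤ (E j) (ed≤length+length (drop j F) Y) ⟩
    E j + (length (drop j F) + length Y) ≡⟨ cong (λ l → E j + (l + length Y)) (length-drop j F) ⟩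
    E j + ((n ∸ j) + length Y)         ≡⟨ +-assoc (E j) _ _ ⟨
    E j + (n ∸ j) + length Y           ≡⟨ cong (_+ length Y) attained ⟨
    finishCost E n + length Y          ∎
    where open ≤-Reasoning

  compress-uncapped : ∀ K E {j} → j ≤ n → finishCost E j ≤ finishCost E n + (K + K) →
                      Σ[ j′ ∈ ℕ ] (j′ ≤ j × compress K E j ≡ E j′ + (j ∸ j′))
  compress-uncapped K E {j} j≤n uncapped with minUpTo-attained (λ j′ → E j′ + (n ∸ j′)) j
  ... | j′ , j′≤j , attained = j′ , j′≤j , (begin
    (finishCost E j ⊓ (finishCost E n + (K + K)) + j) ∸ n ≡⟨ cong (λ t → (t + j) ∸ n) (m≤n⇒m⊓n≡m uncapped) ⟩
    (finishCost E j + j) ∸ n                              ≡⟨ cong (λ t → (t + j) ∸ n) attained ⟩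
    (E j′ + (n ∸ j′) + j) ∸ n                             ≡⟨ cong (λ t → (E j′ + (n ∸ j′) + t) ∸ n) (m+[n∸m]≡n j′≤j) ⟨
    (E j′ + (n ∸ j′) + (j′ + (j ∸ j′))) ∸ n               ≡⟨ cong (_∸ n) (shuffle (E j′) (n ∸ j′) j′ (j ∸ j′)) ⟩
    (E j′ + (j ∸ j′) + ((n ∸ j′) + j′)) ∸ n               ≡⟨ cong (λ t → (E j′ + (j ∸ j′) + t) ∸ n) (m∸n+n≡m (≤-trans j′≤j j≤n)) ⟩
    (E j′ + (j ∸ j′) + n) ∸ n                             ≡⟨ m+n∸n≡m _ n ⟩
    E j′ + (j ∸ j′)                                       ∎)
    where
    open ≡-Reasoning
    shuffle : ∀ a b c d → a + b + (c + d) ≡ a + d + (b + c)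
    shuffle = solve-∀

  viaColumn-compress : ∀ K E Y → length Y ≤ K ⊎ E 0 + n ≤ K + K → viaColumn (compress K E) Y ≡ viaColumn E Y
  viaColumn-compress K E Y short⊎cheap = ≤-antisym
    (minUpTo-greatest _ n λ j≤n → ≤-trans (viaColumn-≤ (compress K E) Y j≤n) (+-monoˡ-≤ _ (compress-≤ K E j≤n)))
    (minUpTo-greatest _ n λ {j} j≤n → atEntry j≤n (finishCost E j ≤? finishCost E n + (K + K)))
    where
    open ≤-Reasoning
    gₙ = finishCost E n
    atCapped : ∀ {j} → j ≤ n → ¬ finishCost E j ≤ gₙ + (K + K) → length Y ≤ K ⊎ E 0 + n ≤ K + K →
               viaColumn E Y ≤ compress K E j + ed (drop j F) Y
    atCapped {j} j≤n capped (inj₂ cheap) = contradiction (begin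
      finishCost E j  ≤⟨ minUpTo-≤ (λ j′ → E j′ + (n ∸ j′)) {j} z≤n ⟩
      E 0 + n         ≤⟨ cheap ⟩
      K + K           ≤⟨ m≤n+m (K + K) gₙ ⟩
      gₙ + (K + K)    ∎) capped
    atCapped {j} j≤n capped (inj₁ short) = begin
      viaColumn E Y                                      ≤⟨ viaColumn-≤-finishCost E Y ⟩
      gₙ + length Y                                      ≤⟨ capped-bound short (≤-trans (≤-reflexive (sym (length-drop j F))) (length≤ed+length (drop j F) Y)) ⟩
      ((gₙ + (K + K) + j) ∸ n) + ed (drop j F) Y         ≡⟨ cong (λ t → ((t + j) ∸ n) + ed (drop j F) Y) (m≥n⇒m⊓n≡n {finishCost E j} (<⇒≤ (≰⇒> capped))) ⟨
      compress K E j + ed (drop j F) Y                   ∎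
      where
      capped-bound : ∀ {e y} → y ≤ K → n ∸ j ≤ e + y → gₙ + y ≤ ((gₙ + (K + K) + j) ∸ n) + e
      capped-bound {e} {y} y≤K n∸j≤e+y = +-cancelʳ-≤ (y + j) _ _ (begin
        gₙ + y + (y + j)              ≡⟨ shuffle₁ gₙ y j ⟩
        gₙ + (y + y) + j              ≤⟨ +-monoˡ-≤ j (+-monoʳ-≤ gₙ (+-mono-≤ y≤K y≤K)) ⟩
        gₙ + (K + K) + j              ≤⟨ m≤n+m∸n (gₙ + (K + K) + j) n ⟩
        n + X                         ≡⟨ cong (_+ X) (m∸n+n≡m j≤n) ⟨
        (n ∸ j) + j + X               ≤⟨ +-monoˡ-≤ X (+-monoˡ-≤ j n∸j≤e+y) ⟩
        (e + y) + j + X               ≡⟨ shuffle₂ e y j X ⟩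
        X + e + (y + j)               ∎)
        where
        X = (gₙ + (K + K) + j) ∸ n
        shuffle₁ : ∀ g y j → g + y + (y + j) ≡ g + (y + y) + j
        shuffle₁ = solve-∀
        shuffle₂ : ∀ e y j X → e + y + j + X ≡ X + e + (y + j)
        shuffle₂ = solve-∀
    atEntry : ∀ {j} → j ≤ n → Dec (finishCost E j ≤ gₙ + (K + K)) → viaColumn E Y ≤ compress K E j + ed (drop j F) Y
    atEntry {j} j≤n (yes uncapped) with compress-uncapped K E j≤n uncapped
    ... | j′ , j′≤j , compressed = begin
      viaColumn E Y                                      ≤⟨ viaColumn-≤ E Y (≤-trans j′≤j j≤n) ⟩
      E j′ + ed (drop j′ F) Y                            ≡⟨ cong (λ u → E j′ + ed u Y) (drop-slice j′≤j) ⟩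
      E j′ + ed (slice j′ j ++ drop j F) Y               ≤⟨ +-monoʳ-≤ (E j′) (ed-++ˡ (slice j′ j) (drop j F) Y) ⟩
      E j′ + (length (slice j′ j) + ed (drop j F) Y)     ≡⟨ cong (λ l → E j′ + (l + ed (drop j F) Y)) (length-slice j′ j≤n) ⟩
      E j′ + ((j ∸ j′) + ed (drop j F) Y)                ≡⟨ +-assoc (E j′) _ _ ⟨
      E j′ + (j ∸ j′) + ed (drop j F) Y                  ≡⟨ cong (_+ ed (drop j F) Y) compressed ⟨
      compress K E j + ed (drop j F) Y                   ∎
    atEntry {j} j≤n (no capped) = atCapped j≤n capped short⊎cheap

  bestMatch-compress : ∀ K E Y → length Y ≤ K ⊎ E 0 + n ≤ K + K → bestMatch (compress K E) Y ≡ bestMatch E Y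
  bestMatch-compress K E Y short⊎cheap = cong (_⊓ minSuffix (ed F) Y) (viaColumn-compress K E Y short⊎cheap)

module _ {P : ℕ → Set} (P? : ∀ i → Dec (P i)) where

  firstFrom : ℕ → ℕ → ℕ
  firstFrom i zero    = i
  firstFrom i (suc f) with P? i
  ... | yes _ = i
  ... | no  _ = firstFrom (suc i) f

  firstFrom-≤ : ∀ i f → firstFrom i f ≤ i + f
  firstFrom-≤ i zero    = m≤m+n i 0
  firstFrom-≤ i (suc f) with P? i
  ... | yes _ = m≤m+n i (suc f)
  ... | no  _ = ≤-trans (firstFrom-≤ (suc i) f) (≤-reflexive (sym (+-suc i f)))

  firstFrom-minimal : ∀ i f {k} → i ≤ k → k < firstFrom i f → ¬ P k
  firstFrom-minimal i zero    i≤k k<i = contradiction i≤k (<⇒≱ k<i)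
  firstFrom-minimal i (suc f) i≤k k< with P? i
  ... | yes _  = contradiction i≤k (<⇒≱ k<)
  ... | no ¬Pi with m≤n⇒m<n∨m≡n i≤k
  ...   | inj₁ i<k = firstFrom-minimal (suc i) f i<k k<
  ...   | inj₂ refl = ¬Pi

  firstFrom-satisfies : ∀ i f → P (i + f) → P (firstFrom i f)
  firstFrom-satisfies i zero    p = subst P (+-identityʳ i) p
  firstFrom-satisfies i (suc f) p with P? i
  ... | yes Pi = Pi
  ... | no  _  = firstFrom-satisfies (suc i) f (subst P (+-suc i f) p)

countAbove : ℕ → List ℕ → ℕ
countAbove j []       = 0
countAbove j (p ∷ ps) with j <? p
... | yes _ = suc (countAbove j ps)
... | no  _ = countAbove j ps

module ColumnCodes {A : Set} (_≟_ : DecidableEquality A) (F : List A) where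
  open EditDistance _≟_
  open Columns _≟_ F

  -- finishCost E is antitone, so it exceeds finishCost E n + δ exactly below threshold E δ.
  threshold : Column → ℕ → ℕ
  threshold E δ = firstFrom (λ j → finishCost E j ≤? finishCost E n + δ) 0 n

  threshold-≤ : ∀ E δ → threshold E δ ≤ n
  threshold-≤ E δ = firstFrom-≤ (λ j → finishCost E j ≤? finishCost E n + δ) 0 n

  <-threshold : ∀ E δ {j} → j ≤ n → j < threshold E δ → δ < finishCost E j ∸ finishCost E n
  <-threshold E δ {j} j≤n j<t = +-cancelˡ-< (finishCost E n) δ _ (begin-strict
    finishCost E n + δ                         <⟨ ≰⇒> (firstFrom-minimal (λ j → finishCost E j ≤? finishCost E n + δ) 0 n z≤n j<t) ⟩
    finishCost E j                             ≡⟨ m+[n∸m]≡n (finishCost-antitone E j≤n) ⟨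
    finishCost E n + (finishCost E j ∸ finishCost E n) ∎)
    where open ≤-Reasoning

  threshold-≤-∸ : ∀ E δ {j} → threshold E δ ≤ j → finishCost E j ∸ finishCost E n ≤ δ
  threshold-≤-∸ E δ {j} t≤j = ≤-trans (∸-monoˡ-≤ (finishCost E n) atThreshold) (≤-reflexive (m+n∸m≡n (finishCost E n) δ))
    where
    atThreshold : finishCost E j ≤ finishCost E n + δ
    atThreshold = ≤-trans (finishCost-antitone E t≤j)
                          (firstFrom-satisfies (λ j → finishCost E j ≤? finishCost E n + δ) 0 n (m≤m+n (finishCost E n) δ))

  thresholds : Column → ℕ → List ℕ
  thresholds E zero    = []
  thresholds E (suc m) = threshold E m ∷ thresholds E m

  countAbove-thresholds : ∀ E m {j} → j ≤ n → countAbove j (thresholds E m) ≡ m ⊓ (finishCost E j ∸ finishCost E n)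
  countAbove-thresholds E zero    j≤n = refl
  countAbove-thresholds E (suc m) {j} j≤n with j <? threshold E m
  ... | yes j<t = begin
    suc (countAbove j (thresholds E m)) ≡⟨ cong suc (countAbove-thresholds E m j≤n) ⟩
    suc (m ⊓ d)                         ≡⟨ cong suc (m≤n⇒m⊓n≡m (<⇒≤ m<d)) ⟩
    suc m                               ≡⟨ m≤n⇒m⊓n≡m m<d ⟨
    suc m ⊓ d                           ∎
    where
    open ≡-Reasoning
    d = finishCost E j ∸ finishCost E n
    m<d = <-threshold E m j≤n j<t
  ... | no j≮t = begin
    countAbove j (thresholds E m)       ≡⟨ countAbove-thresholds E m j≤n ⟩
    m ⊓ d                               ≡⟨ m≥n⇒m⊓n≡n d≤m ⟩
    d                                   ≡⟨ m≥n⇒m⊓n≡n (m≤n⇒m≤1+n d≤m) ⟨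
    suc m ⊓ d                           ∎
    where
    open ≡-Reasoning
    d = finishCost E j ∸ finishCost E n
    d≤m = threshold-≤-∸ E m (≮⇒≥ j≮t)

  -- A column needed for only K more symbols is thus stored as 2K + 1 numbers ≤ n.
  code : ℕ → Column → List ℕ
  code K E = finishCost E n ∷ thresholds E (K + K)

  decode : List ℕ → Column
  decode []       j = 0
  decode (a ∷ ps) j = (a + countAbove j ps + j) ∸ n

  decode-code : ∀ K E {j} → j ≤ n → decode (code K E) j ≡ compress K E j
  decode-code K E {j} j≤n = cong (λ t → (t + j) ∸ n) (begin
    gₙ + countAbove j (thresholds E (K + K)) ≡⟨ cong (gₙ +_) (countAbove-thresholds E (K + K) j≤n) ⟩
    gₙ + ((K + K) ⊓ (gⱼ ∸ gₙ))               ≡⟨ +-distribˡ-⊓ gₙ (K + K) (gⱼ ∸ gₙ) ⟩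
    (gₙ + (K + K)) ⊓ (gₙ + (gⱼ ∸ gₙ))        ≡⟨ cong ((gₙ + (K + K)) ⊓_) (m+[n∸m]≡n (finishCost-antitone E j≤n)) ⟩
    (gₙ + (K + K)) ⊓ gⱼ                      ≡⟨ ⊓-comm (gₙ + (K + K)) gⱼ ⟩
    gⱼ ⊓ (gₙ + (K + K))                      ∎)
    where
    open ≡-Reasoning
    gⱼ = finishCost E j
    gₙ = finishCost E n

  length-thresholds : ∀ E m → length (thresholds E m) ≡ m
  length-thresholds E zero    = refl
  length-thresholds E (suc m) = cong suc (length-thresholds E m)

  length-code : ∀ K E → length (code K E) ≡ suc (K + K)
  length-code K E = cong suc (length-thresholds E (K + K))

  code-< : ∀ K E → E n ≤ n → All (_< suc n) (code K E)
  code-< K E Eₙ≤n = s≤s finishCostₙ≤n ∷ thresholds-< (K + K)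
    where
    finishCostₙ≤n : finishCost E n ≤ n
    finishCostₙ≤n = ≤-trans (minUpTo-≤ (λ j′ → E j′ + (n ∸ j′)) {n} ≤-refl)
                            (≤-trans (≤-reflexive (trans (cong (E n +_) (n∸n≡0 n)) (+-identityʳ (E n)))) Eₙ≤n)
    thresholds-< : ∀ m → All (_< suc n) (thresholds E m)
    thresholds-< zero    = []
    thresholds-< (suc m) = s≤s (threshold-≤ E m) ∷ thresholds-< m

  Represents : ℕ → Column → List A → Set
  Represents K E P = ∀ Y → length Y ≤ K → bestMatch E Y ≡ bestMatch initial (P ++ Y)

  Represents∞ : Column → List A → Set
  Represents∞ E P = ∀ Y → bestMatch E Y ≡ bestMatch initial (P ++ Y)

  bestMatch-cong : ∀ {E E′} Y → (∀ {j} → j ≤ n → E j ≡ E′ j) → bestMatch E Y ≡ bestMatch E′ Y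
  bestMatch-cong Y E≗E′ = cong (_⊓ minSuffix (ed F) Y) (minUpTo-cong n (λ {j} j≤n → cong (_+ ed (drop j F) Y) (E≗E′ j≤n)))

  Represents-decode : ∀ K E P → Represents K E P → Represents K (decode (code K E)) P
  Represents-decode K E P rep Y Y≤K =
    trans (bestMatch-cong Y (decode-code K E)) (trans (bestMatch-compress K E Y (inj₁ Y≤K)) (rep Y Y≤K))

  Represents∞-decode : ∀ K E P → E 0 + n ≤ K + K → Represents∞ E P → Represents∞ (decode (code K E)) P
  Represents∞-decode K E P cheap rep Y =
    trans (bestMatch-cong Y (decode-code K E)) (trans (bestMatch-compress K E Y (inj₂ cheap)) (rep Y))

  Represents-advance : ∀ {K K′} E P X → length X + K ≤ K′ → Represents K′ E P → Represents K (advance E X) (P ++ X)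
  Represents-advance E P X X+K≤K′ rep Y Y≤K = begin
    bestMatch (advance E X) Y       ≡⟨ bestMatch-advance E X Y ⟩
    bestMatch E (X ++ Y)            ≡⟨ rep (X ++ Y) (≤-trans (≤-reflexive (length-++ X)) (≤-trans (+-monoʳ-≤ (length X) Y≤K) X+K≤K′)) ⟩
    bestMatch initial (P ++ X ++ Y) ≡⟨ cong (bestMatch initial) (++-assoc P X Y) ⟨
    bestMatch initial ((P ++ X) ++ Y) ∎
    where open ≡-Reasoning

  Represents∞-advance : ∀ E P X → Represents∞ E P → Represents∞ (advance E X) (P ++ X)
  Represents∞-advance E P X rep Y =
    trans (bestMatch-advance E X Y) (trans (rep (X ++ Y)) (cong (bestMatch initial) (sym (++-assoc P X Y))))

  Represents-output : ∀ E P a → Represents 1 E P → bestMatch E [ a ] ≡ minSuffix (ed F) (P ++ [ a ])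
  Represents-output E P a rep = trans (rep [ a ] ≤-refl) (bestMatch-initial (P ++ [ a ]))

-- Registers held in memory cells

pack : ℕ → List ℕ → ℕ
pack b []       = 0
pack b (d ∷ ds) = d + b * pack b ds

unpack : (b : ℕ) .{{_ : NonZero b}} → ℕ → ℕ → List ℕ
unpack b zero    N = []
unpack b (suc m) N = N % b ∷ unpack b m (N / b)

pack-< : ∀ b ds → All (_< b) ds → pack b ds < b ^ length ds
pack-< b []       []           = s≤s z≤n
pack-< b (d ∷ ds) (d<b ∷ ds<b) = begin-strict
  d + b * pack b ds   <⟨ +-monoˡ-< (b * pack b ds) d<b ⟩
  b + b * pack b ds   ≡⟨ *-suc b (pack b ds) ⟨
  b * suc (pack b ds) ≤⟨ *-monoʳ-≤ b (pack-< b ds ds<b) ⟩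
  b * b ^ length ds   ∎
  where open ≤-Reasoning

unpack-pack : ∀ b .{{_ : NonZero b}} ds → All (_< b) ds → unpack b (length ds) (pack b ds) ≡ ds
unpack-pack b []       []           = refl
unpack-pack b (d ∷ ds) (d<b ∷ ds<b) = cong₂ _∷_ low (trans (cong (unpack b (length ds)) high) (unpack-pack b ds ds<b))
  where
  p = pack b ds
  swap : d + b * p ≡ d + p * b
  swap = cong (d +_) (*-comm b p)
  low : (d + b * p) % b ≡ d
  low = trans (%-congˡ swap) (trans ([m+kn]%n≡m%n d p b) (m<n⇒m%n≡m d<b))
  high : (d + b * p) / b ≡ p
  high = trans (/-congˡ swap) (trans (+-distrib-/-∣ʳ d (n∣m*n p)) (cong₂ _+_ (m<n⇒m/n≡0 d<b) (m*n/n≡m p b)))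

unpack-pack-mod : ∀ b .{{_ : NonZero b}} c .{{_ : NonZero c}} ds → All (_< b) ds → b ^ length ds ≤ c →
                  unpack b (length ds) (pack b ds % c) ≡ ds
unpack-pack-mod b c ds ds<b fits =
  trans (cong (unpack b (length ds)) (m<n⇒m%n≡m (≤-trans (pack-< b ds ds<b) fits))) (unpack-pack b ds ds<b)

pair : ℕ → ℕ → ℕ
pair r j = (r + j) * (r + j) + r

pair-<-diagonal : ∀ {s s′} r r′ → r ≤ s → s < s′ → s * s + r < s′ * s′ + r′
pair-<-diagonal {s} {s′} r r′ r≤s s<s′ = begin-strict
  s * s + r             ≤⟨ +-monoʳ-≤ (s * s) r≤s ⟩
  s * s + s             <⟨ n<1+n _ ⟩
  suc (s * s + s)       ≡⟨ cong suc (+-comm (s * s) s) ⟩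
  suc (s + s * s)       ≤⟨ s≤s (m≤n+m (s + s * s) s) ⟩
  suc (s + (s + s * s)) ≡⟨ cong (λ t → suc (s + t)) (*-suc s s) ⟨
  suc s * suc s         ≤⟨ *-mono-≤ s<s′ s<s′ ⟩
  s′ * s′               ≤⟨ m≤m+n (s′ * s′) r′ ⟩
  s′ * s′ + r′          ∎
  where open ≤-Reasoning

pair-injective : ∀ r j r′ j′ → pair r j ≡ pair r′ j′ → r ≡ r′ × j ≡ j′
pair-injective r j r′ j′ eq with <-cmp (r + j) (r′ + j′)
... | tri< lt _ _ = contradiction eq (<⇒≢ (pair-<-diagonal r r′ (m≤m+n r j) lt))
... | tri> _ _ gt = contradiction (sym eq) (<⇒≢ (pair-<-diagonal r′ r (m≤m+n r′ j′) gt))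
... | tri≈ _ s≡s′ _ = r≡r′ , +-cancelˡ-≡ r j j′ (trans s≡s′ (cong (_+ j′) (sym r≡r′)))
  where
  r≡r′ : r ≡ r′
  r≡r′ = +-cancelˡ-≡ ((r + j) * (r + j)) r r′ (trans eq (cong (λ t → t * t + r′) (sym s≡s′)))

-- Register r occupies width r cells, cell pair (index r) j holding its j-th base-2^w digit.
module RegisterMachine {R : Set} (index : R → ℕ) (index-injective : Injective _≡_ _≡_ index)
                       (w : ℕ) (width : R → ℕ) where

  base : ℕ
  base = 2 ^ w

  instance
    base≢0 : NonZero base
    base≢0 = m^n≢0 2 w

  toWord : ℕ → Word w
  toWord N = fromℕ< (m%n<n N base)

  cell : R → ℕ → ℕ
  cell r j = pair (index r) j

  digits : Memory w → R → ℕ → ℕ → ℕ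
  digits m r j zero    = 0
  digits m r j (suc k) = toℕ (m (cell r j)) + base * digits m r (suc j) k

  infixl 1 _>>=ₚ_
  _>>=ₚ_ : ∀ {X Y : Set} → Prog w X → (X → Prog w Y) → Prog w Y
  ret x       >>=ₚ f = f x
  read j k    >>=ₚ f = read j (λ v → k v >>=ₚ f)
  write j v p >>=ₚ f = write j v (p >>=ₚ f)

  addCost : ∀ {X S : Set} → ℕ → X × S × ℕ → X × S × ℕ
  addCost c (x , s , c′) = x , s , c + c′

  addCost-+ : ∀ {X S : Set} c c′ (t : X × S × ℕ) → addCost c (addCost c′ t) ≡ addCost (c + c′) t
  addCost-+ c c′ (x , s , c″) = cong (λ d → x , s , d) (sym (+-assoc c c′ c″))

  exec-bind : ∀ {X Y : Set} (p : Prog w X) (f : X → Prog w Y) m →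
              exec (p >>=ₚ f) m ≡ addCost (proj₂ (proj₂ (exec p m))) (exec (f (proj₁ (exec p m))) (proj₁ (proj₂ (exec p m))))
  exec-bind (ret x)       f m = refl
  exec-bind (read j k)    f m = cong (addCost 1) (exec-bind (k (m j)) f m)
  exec-bind (write j v p) f m = cong (addCost 1) (exec-bind p f (update w m j v))

  readDigits : R → ℕ → ℕ → Prog w ℕ
  readDigits r j zero    = ret 0
  readDigits r j (suc k) = read (cell r j) (λ v → readDigits r (suc j) k >>=ₚ λ rest → ret (toℕ v + base * rest))

  exec-readDigits : ∀ r j k m → exec (readDigits r j k) m ≡ (digits m r j k , m , k)
  exec-readDigits r j zero    m = refl
  exec-readDigits r j (suc k) m = cong (addCost 1) (begin
    exec (readDigits r (suc j) k >>=ₚ λ rest → ret (v + base * rest)) m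
      ≡⟨ exec-bind (readDigits r (suc j) k) (λ rest → ret (v + base * rest)) m ⟩
    addCost (proj₂ (proj₂ (exec (readDigits r (suc j) k) m))) (v + base * proj₁ (exec (readDigits r (suc j) k) m) , proj₁ (proj₂ (exec (readDigits r (suc j) k) m)) , 0)
      ≡⟨ cong (λ t → addCost (proj₂ (proj₂ t)) (v + base * proj₁ t , proj₁ (proj₂ t) , 0)) (exec-readDigits r (suc j) k m) ⟩
    (v + base * digits m r (suc j) k , m , k + 0)
      ≡⟨ cong (λ c → v + base * digits m r (suc j) k , m , c) (+-identityʳ k) ⟩
    (v + base * digits m r (suc j) k , m , k) ∎)
    where
    open ≡-Reasoning
    v = toℕ (m (cell r j))

  writeDigits : R → ℕ → ℕ → ℕ → Prog w ⊤
  writeDigits r j zero    N = ret tt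
  writeDigits r j (suc k) N = write (cell r j) (toWord N) (writeDigits r (suc j) k (N / base))

  written : Memory w → R → ℕ → ℕ → ℕ → Memory w
  written m r j zero    N = m
  written m r j (suc k) N = written (update w m (cell r j) (toWord N)) r (suc j) k (N / base)

  exec-writeDigits : ∀ r j k N m → exec (writeDigits r j k N) m ≡ (tt , written m r j k N , k)
  exec-writeDigits r j zero    N m = refl
  exec-writeDigits r j (suc k) N m = cong (addCost 1) (exec-writeDigits r (suc j) k (N / base) (update w m (cell r j) (toWord N)))

  update-same : ∀ m a v → update w m a v a ≡ v
  update-same m a v = cong (λ b → if b then v else m a) (dec-true (a ≟ a) refl)

  update-other : ∀ m a v {b} → b ≢ a → update w m a v b ≡ m b
  update-other m a v {b} b≢a = cong (λ c → if c then v else m b) (dec-false (b ≟ a) b≢a)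

  written-other : ∀ m r j k N {a} → (∀ i → i < k → a ≢ cell r (j + i)) → written m r j k N a ≡ m a
  written-other m r j zero    N avoid = refl
  written-other m r j (suc k) N {a} avoid =
    trans (written-other (update w m (cell r j) (toWord N)) r (suc j) k (N / base)
             (λ i i<k → subst (λ t → a ≢ cell r t) (+-suc j i) (avoid (suc i) (s≤s i<k))))
          (update-other m (cell r j) (toWord N) (subst (λ t → a ≢ cell r t) (+-identityʳ j) (avoid 0 z<s)))

  digits-ext : ∀ m m′ r j k → (∀ i → i < k → m (cell r (j + i)) ≡ m′ (cell r (j + i))) → digits m r j k ≡ digits m′ r j k
  digits-ext m m′ r j zero    agree = refl
  digits-ext m m′ r j (suc k) agree = cong₂ (λ a b → toℕ a + base * b)
    (subst (λ t → m (cell r t) ≡ m′ (cell r t)) (+-identityʳ j) (agree 0 z<s))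
    (digits-ext m m′ r (suc j) k (λ i i<k → subst (λ t → m (cell r t) ≡ m′ (cell r t)) (+-suc j i) (agree (suc i) (s≤s i<k))))

  digits-written : ∀ m r j k N → N < base ^ k → digits (written m r j k N) r j k ≡ N
  digits-written m r j zero    zero    _         = refl
  digits-written m r j zero    (suc N) (s≤s ())
  digits-written m r j (suc k) N N<base^k = begin
    toℕ (m′ (cell r j)) + base * digits m′ r (suc j) k ≡⟨ cong₂ (λ a b → toℕ a + base * b) firstCell (digits-written m₁ r (suc j) k (N / base) quotient<) ⟩
    toℕ (toWord N) + base * (N / base)                 ≡⟨ cong (_+ base * (N / base)) (toℕ-fromℕ< (m%n<n N base)) ⟩
    N % base + base * (N / base)                       ≡⟨ cong (N % base +_) (*-comm base (N / base)) ⟩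
    N % base + (N / base) * base                       ≡⟨ m≡m%n+[m/n]*n N base ⟨
    N                                                  ∎
    where
    open ≡-Reasoning
    m₁ = update w m (cell r j) (toWord N)
    m′ = written m₁ r (suc j) k (N / base)
    quotient< : N / base < base ^ k
    quotient< = m<n*o⇒m/o<n (subst (N <_) (*-comm base (base ^ k)) N<base^k)
    firstCell : m′ (cell r j) ≡ toWord N
    firstCell = trans (written-other m₁ r (suc j) k (N / base)
                         (λ i _ eq → <-irrefl (proj₂ (pair-injective (index r) j (index r) (suc j + i) eq)) (s≤s (m≤m+n j i))))
                      (update-same m (cell r j) (toWord N))

  digits-written-other : ∀ m r r′ k k′ N → r′ ≢ r → digits (written m r 0 k N) r′ 0 k′ ≡ digits m r′ 0 k′
  digits-written-other m r r′ k k′ N r′≢r = digits-ext _ _ r′ 0 k′ (λ i _ →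
    written-other m r 0 k N (λ i′ _ eq → r′≢r (index-injective (proj₁ (pair-injective (index r′) i (index r) i′ eq)))))

  Registers : Set
  Registers = R → ℕ

  _≟ᴿ_ : DecidableEquality R
  r ≟ᴿ r′ = map′ index-injective (cong index) (index r ≟ index r′)

  setReg : Registers → R → ℕ → Registers
  setReg st r v r′ = if does (r′ ≟ᴿ r) then v else st r′

  setReg-same : ∀ st r v → setReg st r v r ≡ v
  setReg-same st r v = cong (λ b → if b then v else st r) (dec-true (r ≟ᴿ r) refl)

  setReg-other : ∀ st r v {r′} → r′ ≢ r → setReg st r v r′ ≡ st r′
  setReg-other st r v {r′} r′≢r = cong (λ b → if b then v else st r′) (dec-false (r′ ≟ᴿ r) r′≢r)

  capacity : R → ℕ
  capacity r = base ^ width r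

  instance
    capacity≢0 : ∀ {r} → NonZero (capacity r)
    capacity≢0 {r} = m^n≢0 base (width r)

  data RegProg (X : Set) : Set where
    return : X → RegProg X
    load   : R → (ℕ → RegProg X) → RegProg X
    store  : R → ℕ → RegProg X → RegProg X

  infixl 1 _>>=_
  _>>=_ : ∀ {X Y : Set} → RegProg X → (X → RegProg Y) → RegProg Y
  return x    >>= f = f x
  load r k    >>= f = load r (λ v → k v >>= f)
  store r N p >>= f = store r N (p >>= f)

  run : ∀ {X : Set} → RegProg X → Registers → X × Registers × ℕ
  run (return x)    st = x , st , 0
  run (load r k)    st = addCost (width r) (run (k (st r)) st)
  run (store r N p) st = addCost (width r) (run p (setReg st r (N % capacity r)))

  run-bind : ∀ {X Y : Set} (p : RegProg X) (f : X → RegProg Y) st →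
             run (p >>= f) st ≡ addCost (proj₂ (proj₂ (run p st))) (run (f (proj₁ (run p st))) (proj₁ (proj₂ (run p st))))
  run-bind (return x)    f st = refl
  run-bind (load r k)    f st = trans (cong (addCost (width r)) (run-bind (k (st r)) f st)) (addCost-+ (width r) _ _)
  run-bind (store r N p) f st =
    trans (cong (addCost (width r)) (run-bind p f (setReg st r (N % capacity r)))) (addCost-+ (width r) _ _)

  compile : ∀ {X : Set} → RegProg X → Prog w X
  compile (return x)    = ret x
  compile (load r k)    = readDigits r 0 (width r) >>=ₚ λ v → compile (k v)
  compile (store r N p) = writeDigits r 0 (width r) (N % capacity r) >>=ₚ λ _ → compile p

  Holds : Memory w → Registers → Set
  Holds m st = ∀ r → digits m r 0 (width r) ≡ st r

  Holds-store : ∀ {m st} r N → Holds m st → Holds (written m r 0 (width r) (N % capacity r)) (setReg st r (N % capacity r))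
  Holds-store {m} {st} r N holds r′ with r′ ≟ᴿ r
  ... | yes refl = trans (digits-written m r 0 (width r) (N % capacity r) (m%n<n N (capacity r))) (sym (setReg-same st r _))
  ... | no r′≢r  = trans (digits-written-other m r r′ (width r) (width r′) _ r′≢r) (trans (holds r′) (sym (setReg-other st r _ r′≢r)))

  Simulates : ∀ {X : Set} → X × Memory w × ℕ → X × Registers × ℕ → Set
  Simulates (x , m , c) (x′ , st , c′) = x ≡ x′ × Holds m st × c ≡ c′

  compile-simulates : ∀ {X : Set} (p : RegProg X) {m st} → Holds m st → Simulates (exec (compile p) m) (run p st)
  compile-simulates (return x) holds = refl , holds , refl
  compile-simulates (load r k) {m} {st} holds
    rewrite exec-bind (readDigits r 0 (width r)) (λ v → compile (k v)) m | exec-readDigits r 0 (width r) m | holds r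
    with compile-simulates (k (st r)) holds
  ... | out , holds′ , cost = out , holds′ , cong (width r +_) cost
  compile-simulates (store r N p) {m} {st} holds
    rewrite exec-bind (writeDigits r 0 (width r) (N % capacity r)) (λ _ → compile p) m
          | exec-writeDigits r 0 (width r) (N % capacity r) m
    with compile-simulates p (Holds-store r N holds)
  ... | out , holds′ , cost = out , holds′ , cong (width r +_) cost

  zeroMemory : Memory w
  zeroMemory _ = toWord 0

  Holds-zero : Holds zeroMemory (λ _ → 0)
  Holds-zero r = digits-zero 0 (width r)
    where
    digits-zero : ∀ j k → digits zeroMemory r j k ≡ 0
    digits-zero j zero    = refl
    digits-zero j (suc k) = trans (cong₂ (λ a b → a + base * b) (trans (toℕ-fromℕ< _) (m<n⇒m%n≡m (m^n>0 2 w))) (digits-zero (suc j) k)) (*-zeroʳ base)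

data Reg : Set where
  counter : Reg
  column  : ℕ → Reg
  block   : ℕ → Reg

regIndex : Reg → ℕ
regIndex counter    = pair 0 0
regIndex (column k) = pair 1 k
regIndex (block k)  = pair 2 k

regIndex-injective : Injective _≡_ _≡_ regIndex
regIndex-injective {counter}  {counter}   _  = refl
regIndex-injective {counter}  {column k}  eq = contradiction (proj₁ (pair-injective 0 0 1 k eq)) λ ()
regIndex-injective {counter}  {block k}   eq = contradiction (proj₁ (pair-injective 0 0 2 k eq)) λ ()
regIndex-injective {column k} {counter}   eq = contradiction (proj₁ (pair-injective 1 k 0 0 eq)) λ ()
regIndex-injective {column k} {column k′} eq = cong column (proj₂ (pair-injective 1 k 1 k′ eq))
regIndex-injective {column k} {block k′}  eq = contradiction (proj₁ (pair-injective 1 k 2 k′ eq)) λ ()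
regIndex-injective {block k}  {counter}   eq = contradiction (proj₁ (pair-injective 2 k 0 0 eq)) λ ()
regIndex-injective {block k}  {column k′} eq = contradiction (proj₁ (pair-injective 2 k 1 k′ eq)) λ ()
regIndex-injective {block k}  {block k′}  eq = cong block (proj₂ (pair-injective 2 k 2 k′ eq))

column-injective : ∀ {k k′} → column k ≡ column k′ → k ≡ k′
column-injective refl = refl

block-injective : ∀ {k k′} → block k ≡ block k′ → k ≡ k′
block-injective refl = refl

n<2^n : ∀ n → n < 2 ^ n
n<2^n zero    = s≤s z≤n
n<2^n (suc n) = begin
  suc (suc n)          ≤⟨ s≤s (n<2^n n) ⟩
  suc (2 ^ n)          ≡⟨ +-comm 1 (2 ^ n) ⟩
  2 ^ n + 1            ≤⟨ +-monoʳ-≤ (2 ^ n) (≤-trans (m^n>0 2 n) (≤-reflexive (sym (+-identityʳ (2 ^ n))))) ⟩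
  2 ^ n + (2 ^ n + 0)  ∎
  where open ≤-Reasoning

m^[n∸o]*m^o≡m^n : ∀ m {n o} → o ≤ n → m ^ (n ∸ o) * m ^ o ≡ m ^ n
m^[n∸o]*m^o≡m^n m {n} {o} o≤n = trans (sym (^-distribˡ-+-* m (n ∸ o) o)) (cong (m ^_) (m∸n+n≡m o≤n))

bitValue : Bool → ℕ
bitValue false = 0
bitValue true  = 1

counterValue : List Bool → ℕ
counterValue []       = 0
counterValue (b ∷ bs) = bitValue b * 2 ^ length bs + counterValue bs

counterValue-zeros : ∀ ℓ → counterValue (replicate ℓ false) ≡ 0
counterValue-zeros zero    = refl
counterValue-zeros (suc ℓ) = counterValue-zeros ℓ

segment : (ℕ → ℕ) → ℕ → ℕ → List ℕ
segment f h zero    = []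
segment f h (suc l) = f h ∷ segment f (suc h) l

segment-++ : ∀ f h l l′ → segment f h (l + l′) ≡ segment f h l ++ segment f (h + l) l′
segment-++ f h zero    l′ = cong (λ t → segment f t l′) (sym (+-identityʳ h))
segment-++ f h (suc l) l′ = cong (f h ∷_) (trans (segment-++ f (suc h) l l′) (cong (λ t → segment f (suc h) l ++ segment f t l′) (sym (+-suc h l))))

length-segment : ∀ f h l → length (segment f h l) ≡ l
length-segment f h zero    = refl
length-segment f h (suc l) = cong suc (length-segment f (suc h) l)

segment-< : ∀ {f b} → (∀ i → f i < b) → ∀ h l → All (_< b) (segment f h l)
segment-< f<b h zero    = []
segment-< f<b h (suc l) = f<b h ∷ segment-< f<b (suc h) l

-- With i symbols read, column k summarises the first 2^k⌊i/2^k⌋ symbols for the next 2^k symbols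
-- (column T for ever), the counter holds bits of i mod 2^T, and when bit k is set, block k holds
-- the 2^k symbols from position 2^(k+1)⌊i/2^(k+1)⌋ on.  A carry of 2^ℓ symbols reaching a
-- clear bit ℓ advances column ℓ+1 by those symbols and recompresses the result into columns ℓ … 0.
module Algorithm (w : ℕ) (width : Reg → ℕ) (σ : ℕ) (F : List ℕ) (T : ℕ) where
  open RegisterMachine regIndex regIndex-injective w width public
  open EditDistance _≟_ public
  open Columns _≟_ F public
  open ColumnCodes _≟_ F public

  encodeColumn : ℕ → Column → ℕ
  encodeColumn k E = pack (suc n) (code (2 ^ k) E)

  decodeColumn : ℕ → ℕ → Column
  decodeColumn k v = decode (unpack (suc n) (suc (2 ^ k + 2 ^ k)) v)

  encodeBlock : List ℕ → ℕ
  encodeBlock X = pack (suc σ) X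

  decodeBlock : ℕ → ℕ → List ℕ
  decodeBlock k v = unpack (suc σ) (2 ^ k) v

  encodeBits : List Bool → ℕ
  encodeBits bs = pack 2 (map bitValue bs)

  decodeBits : ℕ → List Bool
  decodeBits v = map (_≡ᵇ 1) (unpack 2 T v)

  storeColumns : ∀ {X : Set} → ℕ → Column → RegProg X → RegProg X
  storeColumns zero    E p = store (column 0) (encodeColumn 0 E) p
  storeColumns (suc ℓ) E p = store (column (suc ℓ)) (encodeColumn (suc ℓ) E) (storeColumns ℓ E p)

  -- inj₁ bs: the carry stopped and left the counter bits bs; inj₂ X: the symbols X are still carried.
  Carry : Set
  Carry = List Bool ⊎ List ℕ

  atZeroBit : ℕ → Carry → RegProg Carry
  atZeroBit ℓ (inj₁ bs) = return (inj₁ (false ∷ bs))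
  atZeroBit ℓ (inj₂ X)  =
    store (block ℓ) (encodeBlock X) (load (column (suc ℓ)) λ c →
    storeColumns ℓ (advance (decodeColumn (suc ℓ) c) X) (return (inj₁ (true ∷ replicate ℓ false))))

  atOneBit : ℕ → Carry → RegProg Carry
  atOneBit ℓ (inj₁ bs) = return (inj₁ (true ∷ bs))
  atOneBit ℓ (inj₂ X)  = load (block ℓ) λ v → return (inj₂ (decodeBlock ℓ v ++ X))

  increment : List Bool → ℕ → RegProg Carry
  increment []           a = return (inj₂ [ a ])
  increment (false ∷ bs) a = increment bs a >>= atZeroBit (length bs)
  increment (true ∷ bs)  a = increment bs a >>= atOneBit (length bs)

  commit : Carry → RegProg ⊤
  commit (inj₁ bs) = store counter (encodeBits bs) (return tt)
  commit (inj₂ X)  = load (column T) λ c →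
    storeColumns T (advance (decodeColumn T c) X) (store counter (encodeBits (replicate T false)) (return tt))

  onArrival : ℕ → RegProg ℕ
  onArrival a = load counter λ v → load (column 0) λ c →
    increment (decodeBits v) a >>= λ r → commit r >>= λ _ → return (bestMatch (decodeColumn 0 c) [ a ])

  preprocess : RegProg ⊤
  preprocess = storeColumns T initial (return tt)

  afterStoreColumns : ℕ → Column → Registers → Registers
  afterStoreColumns zero    E st = setReg st (column 0) (encodeColumn 0 E % capacity (column 0))
  afterStoreColumns (suc ℓ) E st =
    afterStoreColumns ℓ E (setReg st (column (suc ℓ)) (encodeColumn (suc ℓ) E % capacity (column (suc ℓ))))

  storeColumnsCost : ℕ → ℕ
  storeColumnsCost zero    = width (column 0)
  storeColumnsCost (suc ℓ) = width (column (suc ℓ)) + storeColumnsCost ℓ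

  run-storeColumns : ∀ {X : Set} ℓ E (p : RegProg X) st →
                     run (storeColumns ℓ E p) st ≡ addCost (storeColumnsCost ℓ) (run p (afterStoreColumns ℓ E st))
  run-storeColumns zero    E p st = refl
  run-storeColumns (suc ℓ) E p st =
    trans (cong (addCost (width (column (suc ℓ)))) (run-storeColumns ℓ E p _)) (addCost-+ (width (column (suc ℓ))) (storeColumnsCost ℓ) _)

  afterStoreColumns-other : ∀ ℓ E st {r} → (∀ {k} → k ≤ ℓ → r ≢ column k) → afterStoreColumns ℓ E st r ≡ st r
  afterStoreColumns-other zero    E st r≢ = setReg-other st (column 0) _ (r≢ z≤n)
  afterStoreColumns-other (suc ℓ) E st r≢ =
    trans (afterStoreColumns-other ℓ E _ (λ k≤ℓ → r≢ (m≤n⇒m≤1+n k≤ℓ))) (setReg-other st (column (suc ℓ)) _ (r≢ ≤-refl))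

  afterStoreColumns-column : ∀ ℓ E st {k} → k ≤ ℓ → afterStoreColumns ℓ E st (column k) ≡ encodeColumn k E % capacity (column k)
  afterStoreColumns-column zero    E st z≤n = setReg-same st (column 0) _
  afterStoreColumns-column (suc ℓ) E st {k} k≤1+ℓ with m≤n⇒m<n∨m≡n k≤1+ℓ
  ... | inj₁ k<1+ℓ = afterStoreColumns-column ℓ E _ (s≤s⁻¹ k<1+ℓ)
  ... | inj₂ refl  = trans (afterStoreColumns-other ℓ E _ (λ k′≤ℓ eq → <-irrefl (sym (column-injective eq)) (s≤s k′≤ℓ)))
                           (setReg-same st (column (suc ℓ)) _)

  decodeColumn-encode : ∀ k E → E n ≤ n → suc n ^ suc (2 ^ k + 2 ^ k) ≤ capacity (column k) →
                        decodeColumn k (encodeColumn k E % capacity (column k)) ≡ decode (code (2 ^ k) E)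
  decodeColumn-encode k E Eₙ≤n fits = cong decode (begin
    unpack (suc n) (suc (2 ^ k + 2 ^ k)) (encodeColumn k E % capacity (column k))
      ≡⟨ cong (λ l → unpack (suc n) l (encodeColumn k E % capacity (column k))) (length-code (2 ^ k) E) ⟨
    unpack (suc n) (length (code (2 ^ k) E)) (encodeColumn k E % capacity (column k))
      ≡⟨ unpack-pack-mod (suc n) (capacity (column k)) (code (2 ^ k) E) (code-< (2 ^ k) E Eₙ≤n)
           (subst (λ l → suc n ^ l ≤ capacity (column k)) (sym (length-code (2 ^ k) E)) fits) ⟩
    code (2 ^ k) E ∎)
    where open ≡-Reasoning

  decodeBlock-encode : ∀ k X → All (_< suc σ) X → length X ≡ 2 ^ k → suc σ ^ 2 ^ k ≤ capacity (block k) →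
                       decodeBlock k (encodeBlock X % capacity (block k)) ≡ X
  decodeBlock-encode k X X<σ len fits =
    subst (λ l → unpack (suc σ) l (encodeBlock X % capacity (block k)) ≡ X) len
      (unpack-pack-mod (suc σ) (capacity (block k)) X X<σ (subst (λ l → suc σ ^ l ≤ capacity (block k)) (sym len) fits))

  decodeBits-encode : ∀ bs → length bs ≡ T → 2 ^ T ≤ capacity counter → decodeBits (encodeBits bs % capacity counter) ≡ bs
  decodeBits-encode bs refl fits = begin
    map (_≡ᵇ 1) (unpack 2 (length bs) (encodeBits bs % capacity counter))
      ≡⟨ cong (λ l → map (_≡ᵇ 1) (unpack 2 l (encodeBits bs % capacity counter))) (length-map bitValue bs) ⟨
    map (_≡ᵇ 1) (unpack 2 (length (map bitValue bs)) (encodeBits bs % capacity counter))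
      ≡⟨ cong (map (_≡ᵇ 1)) (unpack-pack-mod 2 (capacity counter) (map bitValue bs) (bits<2 bs)
           (subst (λ l → 2 ^ l ≤ capacity counter) (sym (length-map bitValue bs)) fits)) ⟩
    map (_≡ᵇ 1) (map bitValue bs)
      ≡⟨ ≡ᵇ1-bitValue bs ⟩
    bs ∎
    where
    open ≡-Reasoning
    bits<2 : ∀ bs → All (_< 2) (map bitValue bs)
    bits<2 []           = []
    bits<2 (false ∷ bs) = s≤s z≤n ∷ bits<2 bs
    bits<2 (true ∷ bs)  = s≤s (s≤s z≤n) ∷ bits<2 bs
    ≡ᵇ1-bitValue : ∀ bs → map (_≡ᵇ 1) (map bitValue bs) ≡ bs
    ≡ᵇ1-bitValue []           = refl
    ≡ᵇ1-bitValue (false ∷ bs) = cong (false ∷_) (≡ᵇ1-bitValue bs)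
    ≡ᵇ1-bitValue (true ∷ bs)  = cong (true ∷_) (≡ᵇ1-bitValue bs)

  absorbed : ℕ → List ℕ → Registers → Registers
  absorbed ℓ X st = afterStoreColumns ℓ (advance (decodeColumn (suc ℓ) (st′ (column (suc ℓ)))) X) st′
    where
    st′ = setReg st (block ℓ) (encodeBlock X % capacity (block ℓ))

  blockCost zeroBitCost levelCredit : ℕ → ℕ
  blockCost ℓ   = width (block ℓ)
  zeroBitCost ℓ = width (block ℓ) + (width (column (suc ℓ)) + (storeColumnsCost ℓ + 0))
  levelCredit ℓ = 2 ^ (T ∸ ℓ) * (zeroBitCost ℓ + blockCost ℓ)

  run-atZeroBit-carry : ∀ ℓ X st → run (atZeroBit ℓ (inj₂ X)) st ≡ (inj₁ (true ∷ replicate ℓ false) , absorbed ℓ X st , zeroBitCost ℓ)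
  run-atZeroBit-carry ℓ X st = cong (addCost (width (block ℓ))) (cong (addCost (width (column (suc ℓ)))) (run-storeColumns ℓ _ _ _))

  creditBelow : ℕ → ℕ
  creditBelow zero    = 0
  creditBelow (suc ℓ) = creditBelow ℓ + levelCredit ℓ

  fixedCost overflowCost amortisedCost : ℕ
  fixedCost     = width counter + (width (column 0) + width counter)
  overflowCost  = width (column T) + (storeColumnsCost T + (width counter + 0))
  amortisedCost = 2 ^ T * fixedCost + creditBelow T + overflowCost

  -- Costs are scaled by 2^T.  Each step deposits levelCredit ℓ, a 2^-ℓ share of a carry stopping
  -- at bit ℓ, so the 2^ℓ steps between two such carries pay for it; a set bit ℓ also holds the
  -- cost of reading block ℓ when the next carry passes through it.
  potential : List Bool → ℕ
  potential []           = 0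
  potential (false ∷ bs) = potential bs + counterValue bs * levelCredit (length bs)
  potential (true ∷ bs)  = potential bs + counterValue bs * levelCredit (length bs) + 2 ^ T * blockCost (length bs)

  counterValue-one-zeros : ∀ ℓ → counterValue (true ∷ replicate ℓ false) ≡ 2 ^ ℓ
  counterValue-one-zeros ℓ =
    trans (cong₂ (λ l v → 1 * 2 ^ l + v) (length-replicate ℓ) (counterValue-zeros ℓ)) (trans (+-identityʳ _) (*-identityˡ _))


  counterPotential : List Bool → ℕ
  counterPotential bs = potential bs + counterValue bs * overflowCost

  potential-zeros : ∀ ℓ → potential (replicate ℓ false) ≡ 0
  potential-zeros zero    = refl
  potential-zeros (suc ℓ) = cong₂ (λ p v → p + v * levelCredit (length (replicate ℓ false))) (potential-zeros ℓ) (counterValue-zeros ℓ)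

  potential-one-zeros : ∀ ℓ → potential (true ∷ replicate ℓ false) ≡ 2 ^ T * blockCost ℓ
  potential-one-zeros ℓ rewrite potential-zeros ℓ | counterValue-zeros ℓ | length-replicate ℓ {x = false} = refl

  counterPotential-zeros : counterPotential (replicate T false) ≡ 0
  counterPotential-zeros = cong₂ (λ p v → p + v * overflowCost) (potential-zeros T) (counterValue-zeros T)

  levelCredit-spread : ∀ {ℓ} → ℓ ≤ T → 2 ^ T * (zeroBitCost ℓ + blockCost ℓ) ≡ 2 ^ ℓ * levelCredit ℓ
  levelCredit-spread {ℓ} ℓ≤T = begin
    2 ^ T * c                   ≡⟨ cong (λ t → 2 ^ t * c) (m+[n∸m]≡n ℓ≤T) ⟨
    2 ^ (ℓ + (T ∸ ℓ)) * c       ≡⟨ cong (_* c) (^-distribˡ-+-* 2 ℓ (T ∸ ℓ)) ⟩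
    2 ^ ℓ * 2 ^ (T ∸ ℓ) * c     ≡⟨ *-assoc (2 ^ ℓ) (2 ^ (T ∸ ℓ)) c ⟩
    2 ^ ℓ * levelCredit ℓ       ∎
    where
    open ≡-Reasoning
    c = zeroBitCost ℓ + blockCost ℓ

  committed : Carry → Registers → Registers
  committed (inj₁ bs) st = setReg st counter (encodeBits bs % capacity counter)
  committed (inj₂ X)  st =
    setReg (afterStoreColumns T (advance (decodeColumn T (st (column T))) X) st) counter (encodeBits (replicate T false) % capacity counter)

  commitCost : Carry → ℕ
  commitCost (inj₁ _) = width counter
  commitCost (inj₂ _) = overflowCost

  run-commit : ∀ r st → run (commit r) st ≡ (tt , committed r st , commitCost r)
  run-commit (inj₁ bs) st = cong (λ c → tt , committed (inj₁ bs) st , c) (+-identityʳ _)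
  run-commit (inj₂ X)  st = cong (addCost (width (column T))) (run-storeColumns T _ _ st)

  arrival : ℕ → Registers → Carry × Registers × ℕ → ℕ × Registers × ℕ
  arrival a st (r , st₁ , c) =
    bestMatch (decodeColumn 0 (st (column 0))) [ a ] , committed r st₁ , width counter + (width (column 0) + (c + commitCost r))

  run-onArrival : ∀ a st → run (onArrival a) st ≡ arrival a st (run (increment (decodeBits (st counter)) a) st)
  run-onArrival a st =
    trans (cong (λ t → addCost (width counter) (addCost (width (column 0)) t)) (run-bind (increment (decodeBits (st counter)) a) finish st))
          (finish-run (run (increment (decodeBits (st counter)) a) st))
    where
    out = bestMatch (decodeColumn 0 (st (column 0))) [ a ]
    finish : Carry → RegProg ℕ
    finish r = commit r >>= λ _ → return out
    finish-run : ∀ t → addCost (width counter) (addCost (width (column 0))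
                         (addCost (proj₂ (proj₂ t)) (run (finish (proj₁ t)) (proj₁ (proj₂ t))))) ≡ arrival a st t
    finish-run (r , st₁ , c) = cong (λ t → addCost (width counter) (addCost (width (column 0)) (addCost c t))) (begin
      run (finish r) st₁                                                 ≡⟨ run-bind (commit r) (λ _ → return out) st₁ ⟩
      addCost (proj₂ (proj₂ (run (commit r) st₁))) (out , proj₁ (proj₂ (run (commit r) st₁)) , 0)
        ≡⟨ cong (λ t → addCost (proj₂ (proj₂ t)) (out , proj₁ (proj₂ t) , 0)) (run-commit r st₁) ⟩
      (out , committed r st₁ , commitCost r + 0)                         ≡⟨ cong (λ c → out , committed r st₁ , c) (+-identityʳ _) ⟩
      (out , committed r st₁ , commitCost r)                             ∎)
      where open ≡-Reasoning

  module Run (S′ : ℕ → ℕ) (S′<σ : ∀ i → S′ i < σ) (n≤2^T : n ≤ 2 ^ T)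
             (column-fits : ∀ {k} → k ≤ T → suc n ^ suc (2 ^ k + 2 ^ k) ≤ capacity (column k))
             (block-fits : ∀ {k} → k < T → suc σ ^ 2 ^ k ≤ capacity (block k))
             (counter-fits : 2 ^ T ≤ capacity counter) where

    prefix : ℕ → List ℕ
    prefix p = segment S′ 0 p

    prefix-++ : ∀ p l → prefix p ++ segment S′ p l ≡ prefix (p + l)
    prefix-++ p l = sym (segment-++ S′ 0 p l)

    ColumnOK : ℕ → ℕ → Registers → Set
    ColumnOK k p st = Represents (2 ^ k) (decodeColumn k (st (column k))) (prefix p)

    TopOK : ℕ → Registers → Set
    TopOK p st = Represents∞ (decodeColumn T (st (column T))) (prefix p)

    BlockOK : ℕ → ℕ → Registers → Set
    BlockOK k p st = decodeBlock k (st (block k)) ≡ segment S′ p (2 ^ k)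

    BitsOK : List Bool → ℕ → Registers → Set
    BitsOK []           p st = ColumnOK 0 p st
    BitsOK (false ∷ bs) p st = ColumnOK (suc (length bs)) p st × BitsOK bs p st
    BitsOK (true ∷ bs)  p st = ColumnOK (suc (length bs)) p st × BlockOK (length bs) p st × BitsOK bs (p + 2 ^ length bs) st

    Unchanged : ℕ → Registers → Registers → Set
    Unchanged L st st′ = ∀ {k} → L ≤ k → st′ (column k) ≡ st (column k) × st′ (block k) ≡ st (block k)

    ColumnOK-cong : ∀ {k p st st′} → st′ (column k) ≡ st (column k) → ColumnOK k p st → ColumnOK k p st′
    ColumnOK-cong {k} {p} eq ok = subst (λ v → Represents (2 ^ k) (decodeColumn k v) (prefix p)) (sym eq) ok

    BitsOK-cong : ∀ bs {p st st′} → (∀ k → st′ (column k) ≡ st (column k)) → (∀ k → st′ (block k) ≡ st (block k)) →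
                  BitsOK bs p st → BitsOK bs p st′
    BitsOK-cong []           {p} {st} {st′} same-column same-block ok =
      ColumnOK-cong {0} {p} {st} {st′} (same-column 0) ok
    BitsOK-cong (false ∷ bs) {p} {st} {st′} same-column same-block (column-ok , ok) =
      ColumnOK-cong {suc (length bs)} {p} {st} {st′} (same-column _) column-ok , BitsOK-cong bs same-column same-block ok
    BitsOK-cong (true ∷ bs)  {p} {st} {st′} same-column same-block (column-ok , block-ok , ok) =
      ColumnOK-cong {suc (length bs)} {p} {st} {st′} (same-column _) column-ok ,
      trans (cong (decodeBlock (length bs)) (same-block (length bs))) block-ok ,
      BitsOK-cong bs same-column same-block ok

    BitsOK-zeros : ∀ ℓ {p st} → (∀ {k} → k ≤ ℓ → ColumnOK k p st) → BitsOK (replicate ℓ false) p st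
    BitsOK-zeros zero            columns-ok = columns-ok z≤n
    BitsOK-zeros (suc ℓ) {p} {st} columns-ok =
      subst (λ l → ColumnOK (suc l) p st) (sym (length-replicate ℓ)) (columns-ok ≤-refl) ,
      BitsOK-zeros ℓ (λ k≤ℓ → columns-ok (m≤n⇒m≤1+n k≤ℓ))

    BitsOK-column0 : ∀ bs {p st} → BitsOK bs p st → ColumnOK 0 (p + counterValue bs) st
    BitsOK-column0 []           {p} {st} ok           = subst (λ q → ColumnOK 0 q st) (sym (+-identityʳ p)) ok
    BitsOK-column0 (false ∷ bs)          (_ , ok)     = BitsOK-column0 bs ok
    BitsOK-column0 (true ∷ bs)  {p} {st} (_ , _ , ok) =
      subst (λ q → ColumnOK 0 q st) (trans (+-assoc p (2 ^ length bs) (counterValue bs)) (cong (λ t → p + (t + counterValue bs)) (sym (*-identityˡ _))))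
            (BitsOK-column0 bs ok)

    decodeColumn-afterStore : ∀ ℓ E st {k} → E n ≤ n → ℓ ≤ T → k ≤ ℓ →
                              decodeColumn k (afterStoreColumns ℓ E st (column k)) ≡ decode (code (2 ^ k) E)
    decodeColumn-afterStore ℓ E st {k} Eₙ≤n ℓ≤T k≤ℓ =
      trans (cong (decodeColumn k) (afterStoreColumns-column ℓ E st k≤ℓ)) (decodeColumn-encode k E Eₙ≤n (column-fits (≤-trans k≤ℓ ℓ≤T)))

    columns-ok-after-store : ∀ ℓ E P {st p} → E n ≤ n → ℓ ≤ T → P ≡ prefix p →
                             (∀ {k} → k ≤ ℓ → Represents (2 ^ k) E P) → ∀ {k} → k ≤ ℓ → ColumnOK k p (afterStoreColumns ℓ E st)
    columns-ok-after-store ℓ E P {st} Eₙ≤n ℓ≤T refl rep {k} k≤ℓ =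
      subst (λ v → Represents (2 ^ k) v P) (sym (decodeColumn-afterStore ℓ E st Eₙ≤n ℓ≤T k≤ℓ)) (Represents-decode (2 ^ k) E P (rep k≤ℓ))

    IncrementResult : List Bool → ℕ → ℕ → Carry → Registers → Set
    IncrementResult bs p c (inj₁ bs′) st′ =
      length bs′ ≡ length bs × counterValue bs′ ≡ suc (counterValue bs) × BitsOK bs′ p st′ ×
      2 ^ T * c + potential bs′ ≤ potential bs + creditBelow (length bs)
    IncrementResult bs p c (inj₂ X)   st′ =
      X ≡ segment S′ p (2 ^ length bs) × suc (counterValue bs) ≡ 2 ^ length bs ×
      2 ^ T * c ≤ potential bs + creditBelow (length bs)

    IncrementOK : List Bool → ℕ → Registers → Carry × Registers × ℕ → Set
    IncrementOK bs p st (r , st′ , c) = Unchanged (length bs) st st′ × IncrementResult bs p c r st′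

    Unchanged-suc : ∀ {L st st′} → Unchanged L st st′ → Unchanged (suc L) st st′
    Unchanged-suc unchanged L<k = unchanged (<⇒≤ L<k)

    zeroBit-keeps : ∀ bs {p st} bs′ st₁ c → ColumnOK (suc (length bs)) p st → IncrementOK bs p st (inj₁ bs′ , st₁ , c) →
                    IncrementOK (false ∷ bs) p st (inj₁ (false ∷ bs′) , st₁ , c + 0)
    zeroBit-keeps bs {p} {st} bs′ st₁ c column-ok (unchanged , same-length , value , ok , amortised)
      rewrite same-length | value | +-identityʳ c =
      Unchanged-suc {length bs} {st} {st₁} unchanged , refl , refl ,
      (ColumnOK-cong {suc (length bs)} {p} {st} {st₁} (proj₁ (unchanged (n≤1+n _))) column-ok , ok) ,
      accounting (2 ^ T * c) (potential bs′) (potential bs) (creditBelow (length bs)) (counterValue bs) (levelCredit (length bs)) amortised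
      where
      accounting : ∀ x P′ P A v b → x + P′ ≤ P + A → x + (P′ + suc v * b) ≤ (P + v * b) + (A + b)
      accounting x P′ P A v b h = begin
        x + (P′ + suc v * b)    ≡⟨ e₁ x P′ v b ⟩
        (x + P′) + (b + v * b)  ≤⟨ +-monoˡ-≤ (b + v * b) h ⟩
        (P + A) + (b + v * b)   ≡⟨ e₂ P A v b ⟩
        (P + v * b) + (A + b)   ∎
        where
        open ≤-Reasoning
        e₁ : ∀ x P′ v b → x + (P′ + suc v * b) ≡ (x + P′) + (b + v * b)
        e₁ = solve-∀
        e₂ : ∀ P A v b → (P + A) + (b + v * b) ≡ (P + v * b) + (A + b)
        e₂ = solve-∀

    oneBit-keeps : ∀ bs {p st} bs′ st₁ c → ColumnOK (suc (length bs)) p st → BlockOK (length bs) p st →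
                   IncrementOK bs (p + 2 ^ length bs) st (inj₁ bs′ , st₁ , c) →
                   IncrementOK (true ∷ bs) p st (inj₁ (true ∷ bs′) , st₁ , c + 0)
    oneBit-keeps bs {p} {st} bs′ st₁ c column-ok block-ok (unchanged , same-length , value , ok , amortised)
      rewrite same-length | value =
      Unchanged-suc {length bs} {st} {st₁} unchanged , refl , +-suc _ _ ,
      (ColumnOK-cong {suc (length bs)} {p} {st} {st₁} (proj₁ (unchanged (n≤1+n _))) column-ok ,
       trans (cong (decodeBlock (length bs)) (proj₂ (unchanged ≤-refl))) block-ok , ok) ,
      accounting (2 ^ T) c (potential bs′) (potential bs) (creditBelow (length bs)) (counterValue bs) (levelCredit (length bs)) (blockCost (length bs)) amortised
      where
      accounting : ∀ t c P′ P A v b λ′ → t * c + P′ ≤ P + A → t * (c + 0) + (P′ + suc v * b + t * λ′) ≤ (P + v * b + t * λ′) + (A + b)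
      accounting t c P′ P A v b λ′ h = begin
        t * (c + 0) + (P′ + suc v * b + t * λ′)  ≡⟨ e₁ t c P′ v b λ′ ⟩
        (t * c + P′) + (b + v * b + t * λ′)      ≤⟨ +-monoˡ-≤ _ h ⟩
        (P + A) + (b + v * b + t * λ′)           ≡⟨ e₂ P A v b t λ′ ⟩
        (P + v * b + t * λ′) + (A + b)           ∎
        where
        open ≤-Reasoning
        e₁ : ∀ t c P′ v b λ′ → t * (c + 0) + (P′ + suc v * b + t * λ′) ≡ (t * c + P′) + (b + v * b + t * λ′)
        e₁ = solve-∀
        e₂ : ∀ P A v b t λ′ → (P + A) + (b + v * b + t * λ′) ≡ (P + v * b + t * λ′) + (A + b)
        e₂ = solve-∀

    oneBit-carries : ∀ bs {p st} X′ st₁ c → BlockOK (length bs) p st →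
                     IncrementOK bs (p + 2 ^ length bs) st (inj₂ X′ , st₁ , c) →
                     IncrementOK (true ∷ bs) p st (inj₂ (decodeBlock (length bs) (st₁ (block (length bs))) ++ X′) , st₁ , c + (blockCost (length bs) + 0))
    oneBit-carries bs {p} {st} X′ st₁ c block-ok (unchanged , X′≡ , full , amortised) =
      Unchanged-suc {ℓ} {st} {st₁} unchanged , carried , value ,
      accounting (2 ^ T) c (potential bs) (creditBelow ℓ) (counterValue bs) (levelCredit ℓ) (blockCost ℓ) amortised
      where
      ℓ = length bs
      carried : decodeBlock ℓ (st₁ (block ℓ)) ++ X′ ≡ segment S′ p (2 ^ suc ℓ)
      carried = begin
        decodeBlock ℓ (st₁ (block ℓ)) ++ X′                    ≡⟨ cong₂ _++_ (trans (cong (decodeBlock ℓ) (proj₂ (unchanged ≤-refl))) block-ok) X′≡ ⟩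
        segment S′ p (2 ^ ℓ) ++ segment S′ (p + 2 ^ ℓ) (2 ^ ℓ) ≡⟨ segment-++ S′ p (2 ^ ℓ) (2 ^ ℓ) ⟨
        segment S′ p (2 ^ ℓ + 2 ^ ℓ)                           ≡⟨ cong (λ t → segment S′ p (2 ^ ℓ + t)) (+-identityʳ (2 ^ ℓ)) ⟨
        segment S′ p (2 ^ suc ℓ)                               ∎
        where open ≡-Reasoning
      value : suc (1 * 2 ^ ℓ + counterValue bs) ≡ 2 ^ suc ℓ
      value = begin
        suc (1 * 2 ^ ℓ + counterValue bs)   ≡⟨ +-suc (1 * 2 ^ ℓ) (counterValue bs) ⟨
        1 * 2 ^ ℓ + suc (counterValue bs)   ≡⟨ cong₂ _+_ (*-identityˡ (2 ^ ℓ)) full ⟩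
        2 ^ ℓ + 2 ^ ℓ                       ≡⟨ cong (2 ^ ℓ +_) (+-identityʳ (2 ^ ℓ)) ⟨
        2 ^ suc ℓ                           ∎
        where open ≡-Reasoning
      accounting : ∀ t c P A v b λ′ → t * c ≤ P + A → t * (c + (λ′ + 0)) ≤ (P + v * b + t * λ′) + (A + b)
      accounting t c P A v b λ′ h = begin
        t * (c + (λ′ + 0))              ≡⟨ e₁ t c λ′ ⟩
        t * c + t * λ′                  ≤⟨ +-monoˡ-≤ _ h ⟩
        (P + A) + t * λ′                ≤⟨ m≤m+n _ (v * b + b) ⟩
        (P + A) + t * λ′ + (v * b + b)  ≡⟨ e₂ P A v b t λ′ ⟩
        (P + v * b + t * λ′) + (A + b)  ∎
        where
        open ≤-Reasoning
        e₁ : ∀ t c λ′ → t * (c + (λ′ + 0)) ≡ t * c + t * λ′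
        e₁ = solve-∀
        e₂ : ∀ P A v b t λ′ → (P + A) + t * λ′ + (v * b + b) ≡ (P + v * b + t * λ′) + (A + b)
        e₂ = solve-∀

    BitsOK-one-zeros : ∀ ℓ {p st} → ColumnOK (suc ℓ) p st → BlockOK ℓ p st → (∀ {k} → k ≤ ℓ → ColumnOK k (p + 2 ^ ℓ) st) →
                       BitsOK (true ∷ replicate ℓ false) p st
    BitsOK-one-zeros ℓ column-ok block-ok columns-ok rewrite length-replicate ℓ {x = false} =
      column-ok , block-ok , BitsOK-zeros ℓ columns-ok

    zeroBit-absorbs : ∀ bs {p st} X st₁ c → length bs < T → ColumnOK (suc (length bs)) p st →
                      IncrementOK bs p st (inj₂ X , st₁ , c) →
                      IncrementOK (false ∷ bs) p st (inj₁ (true ∷ replicate (length bs) false) , absorbed (length bs) X st₁ , c + zeroBitCost (length bs))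
    zeroBit-absorbs bs {p} {st} X st₁ c ℓ<T column-ok (unchanged , X≡ , full , amortised) =
      unchanged′ , cong suc (length-replicate ℓ) , trans (counterValue-one-zeros ℓ) (sym full) ,
      BitsOK-one-zeros ℓ (ColumnOK-cong {suc ℓ} {p} {st} {st₃} (proj₁ (unchanged′ ≤-refl)) column-ok) block-ok columns-ok ,
      subst (λ q → 2 ^ T * (c + zeroBitCost ℓ) + q ≤ potential (false ∷ bs) + creditBelow (suc ℓ)) (sym (potential-one-zeros ℓ))
        (accounting (2 ^ T) c (zeroBitCost ℓ) (blockCost ℓ) (potential bs) (creditBelow ℓ) (counterValue bs) (levelCredit ℓ) amortised
          (≤-reflexive (trans (levelCredit-spread (<⇒≤ ℓ<T)) (cong (_* levelCredit ℓ) (sym full)))))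
      where
      ℓ = length bs
      st₂ = setReg st₁ (block ℓ) (encodeBlock X % capacity (block ℓ))
      E = decodeColumn (suc ℓ) (st₂ (column (suc ℓ)))
      st₃ = absorbed ℓ X st₁
      unchanged′ : Unchanged (suc ℓ) st st₃
      unchanged′ {k} ℓ<k =
        trans (afterStoreColumns-other ℓ (advance E X) st₂ (λ k′≤ℓ eq → <-irrefl (sym (column-injective eq)) (≤-<-trans k′≤ℓ ℓ<k)))
              (trans (setReg-other st₁ (block ℓ) _ (λ ())) (proj₁ (unchanged (<⇒≤ ℓ<k)))) ,
        trans (afterStoreColumns-other ℓ (advance E X) st₂ (λ _ ()))
              (trans (setReg-other st₁ (block ℓ) _ (λ eq → <-irrefl (sym (block-injective eq)) ℓ<k)) (proj₂ (unchanged (<⇒≤ ℓ<k))))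
      length-X : length X ≡ 2 ^ ℓ
      length-X = trans (cong length X≡) (length-segment S′ p (2 ^ ℓ))
      X<σ : All (_< suc σ) X
      X<σ = subst (All (_< suc σ)) (sym X≡) (segment-< (λ i → m<n⇒m<1+n (S′<σ i)) p (2 ^ ℓ))
      block-ok : BlockOK ℓ p st₃
      block-ok = trans (cong (decodeBlock ℓ) (trans (afterStoreColumns-other ℓ (advance E X) st₂ (λ _ ())) (setReg-same st₁ (block ℓ) _)))
                       (trans (decodeBlock-encode ℓ X X<σ length-X (block-fits ℓ<T)) X≡)
      old : Represents (2 ^ suc ℓ) E (prefix p)
      old = ColumnOK-cong {suc ℓ} {p} {st} {st₂} (trans (setReg-other st₁ (block ℓ) _ (λ ())) (proj₁ (unchanged (n≤1+n ℓ)))) column-ok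
      room : ∀ {k} → k ≤ ℓ → length X + 2 ^ k ≤ 2 ^ suc ℓ
      room {k} k≤ℓ = subst (length X + 2 ^ k ≤_) (cong (2 ^ ℓ +_) (sym (+-identityʳ (2 ^ ℓ))))
                       (+-mono-≤ (≤-reflexive length-X) (^-monoʳ-≤ 2 k≤ℓ))
      columns-ok : ∀ {k} → k ≤ ℓ → ColumnOK k (p + 2 ^ ℓ) st₃
      columns-ok = columns-ok-after-store ℓ (advance E X) (prefix p ++ X) (advance-at-n E X) (<⇒≤ ℓ<T)
                     (trans (cong (prefix p ++_) X≡) (prefix-++ p (2 ^ ℓ)))
                     (λ k≤ℓ → Represents-advance E (prefix p) X (room k≤ℓ) old)
      accounting : ∀ t c W λ′ P A v b → t * c ≤ P + A → t * (W + λ′) ≤ suc v * b → t * (c + W) + t * λ′ ≤ (P + v * b) + (A + b)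
      accounting t c W λ′ P A v b h₁ h₂ = begin
        t * (c + W) + t * λ′    ≡⟨ e₁ t c W λ′ ⟩
        t * c + t * (W + λ′)    ≤⟨ +-mono-≤ h₁ h₂ ⟩
        (P + A) + suc v * b     ≡⟨ e₂ P A v b ⟩
        (P + v * b) + (A + b)   ∎
        where
        open ≤-Reasoning
        e₁ : ∀ t c W λ′ → t * (c + W) + t * λ′ ≡ t * c + t * (W + λ′)
        e₁ = solve-∀
        e₂ : ∀ P A v b → (P + A) + suc v * b ≡ (P + v * b) + (A + b)
        e₂ = solve-∀

    position-after-one : ∀ p bs → p + counterValue (true ∷ bs) ≡ p + 2 ^ length bs + counterValue bs
    position-after-one p bs = trans (cong (λ t → p + (t + counterValue bs)) (*-identityˡ _)) (sym (+-assoc p _ _))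

    increment-correct : ∀ bs {p st a} → length bs ≤ T → BitsOK bs p st → a ≡ S′ (p + counterValue bs) →
                        IncrementOK bs p st (run (increment bs a) st)
    increment-correct []           {p} _ _ a≡ =
      (λ _ → refl , refl) , cong [_] (trans a≡ (cong S′ (+-identityʳ p))) , refl , ≤-reflexive (*-zeroʳ (2 ^ T))
    increment-correct (false ∷ bs) {p} {st} {a} len (column-ok , ok) a≡
      rewrite run-bind (increment bs a) (atZeroBit (length bs)) st
      with run (increment bs a) st | increment-correct bs (≤-trans (n≤1+n _) len) ok a≡
    ... | inj₁ bs′ , st₁ , c | ih = zeroBit-keeps bs {p} {st} bs′ st₁ c column-ok ih
    ... | inj₂ X   , st₁ , c | ih =
      subst (λ t → IncrementOK (false ∷ bs) p st (addCost c t)) (sym (run-atZeroBit-carry (length bs) X st₁))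
        (zeroBit-absorbs bs {p} {st} X st₁ c len column-ok ih)
    increment-correct (true ∷ bs)  {p} {st} {a} len (column-ok , block-ok , ok) a≡
      rewrite run-bind (increment bs a) (atOneBit (length bs)) st
      with run (increment bs a) st | increment-correct bs (≤-trans (n≤1+n _) len) ok (trans a≡ (cong S′ (position-after-one p bs)))
    ... | inj₁ bs′ , st₁ , c | ih = oneBit-keeps bs {p} {st} bs′ st₁ c column-ok block-ok ih
    ... | inj₂ X′  , st₁ , c | ih = oneBit-carries bs {p} {st} X′ st₁ c block-ok ih

    Invariant : ℕ → Registers → Set
    Invariant i st = Σ[ bs ∈ List Bool ] Σ[ p ∈ ℕ ]
      (length bs ≡ T × decodeBits (st counter) ≡ bs × TopOK p st × BitsOK bs p st × p + counterValue bs ≡ i)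

    storedPotential : Registers → ℕ
    storedPotential st = counterPotential (decodeBits (st counter))

    answer : ℕ → ℕ
    answer i = minSuffix (ed F) (prefix (suc i))

    output-correct : ∀ {i st} bs p → BitsOK bs p st → p + counterValue bs ≡ i →
                     bestMatch (decodeColumn 0 (st (column 0))) [ S′ i ] ≡ answer i
    output-correct {i} {st} bs p ok refl =
      trans (Represents-output _ (prefix i) (S′ i) (BitsOK-column0 bs ok)) (cong (minSuffix (ed F)) (trans (prefix-++ i 1) (cong prefix (+-comm i 1))))

    decodeBits-committed : ∀ bs st → length bs ≡ T → decodeBits (committed (inj₁ bs) st counter) ≡ bs
    decodeBits-committed bs st len = trans (cong decodeBits (setReg-same st counter _)) (decodeBits-encode bs len counter-fits)

    step-keeps : ∀ {i st} bs p bs′ st₁ c → length bs ≡ T → decodeBits (st counter) ≡ bs → TopOK p st → p + counterValue bs ≡ i →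
                 IncrementOK bs p st (inj₁ bs′ , st₁ , c) →
                 Invariant (suc i) (committed (inj₁ bs′) st₁) ×
                 2 ^ T * (width counter + (width (column 0) + (c + width counter))) + storedPotential (committed (inj₁ bs′) st₁)
                   ≤ storedPotential st + amortisedCost
    step-keeps {i} {st} bs p bs′ st₁ c refl decoded top position (unchanged , same-length , value , ok , amortised) =
      (bs′ , p , same-length , decoded′ , top′ , BitsOK-cong bs′ (λ _ → setReg-other st₁ counter v (λ ())) (λ _ → setReg-other st₁ counter v (λ ())) ok ,
       trans (cong (p +_) value) (trans (+-suc p _) (cong suc position))) ,
      subst (λ q → 2 ^ T * (wᶜ + (w₀ + (c + wᶜ))) + q ≤ storedPotential st + amortisedCost) (sym (cong counterPotential decoded′))
        (subst (λ q → 2 ^ T * (wᶜ + (w₀ + (c + wᶜ))) + counterPotential bs′ ≤ counterPotential q + amortisedCost) (sym decoded)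
          (subst (λ v → 2 ^ T * (wᶜ + (w₀ + (c + wᶜ))) + (potential bs′ + v * overflowCost) ≤ counterPotential bs + amortisedCost) (sym value)
            (accounting (2 ^ T) wᶜ w₀ c (potential bs′) (potential bs) (creditBelow (length bs)) overflowCost (counterValue bs) amortised)))
      where
      wᶜ = width counter
      w₀ = width (column 0)
      decoded′ : decodeBits (committed (inj₁ bs′) st₁ counter) ≡ bs′
      decoded′ = decodeBits-committed bs′ st₁ same-length
      v = encodeBits bs′ % capacity counter
      top′ : TopOK p (committed (inj₁ bs′) st₁)
      top′ = subst (λ x → Represents∞ (decodeColumn T x) (prefix p))
               (sym (trans (setReg-other st₁ counter v (λ ())) (proj₁ (unchanged ≤-refl)))) top
      accounting : ∀ t k₁ k₂ c P′ P A o v → t * c + P′ ≤ P + A →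
                   t * (k₁ + (k₂ + (c + k₁))) + (P′ + suc v * o) ≤ (P + v * o) + (t * (k₁ + (k₂ + k₁)) + A + o)
      accounting t k₁ k₂ c P′ P A o v h = begin
        t * (k₁ + (k₂ + (c + k₁))) + (P′ + suc v * o)        ≡⟨ e₁ t k₁ k₂ c P′ v o ⟩
        (t * c + P′) + (t * (k₁ + (k₂ + k₁)) + o + v * o)    ≤⟨ +-monoˡ-≤ _ h ⟩
        (P + A) + (t * (k₁ + (k₂ + k₁)) + o + v * o)         ≡⟨ e₂ P A t k₁ k₂ o v ⟩
        (P + v * o) + (t * (k₁ + (k₂ + k₁)) + A + o)         ∎
        where
        open ≤-Reasoning
        e₁ : ∀ t k₁ k₂ c P′ v o → t * (k₁ + (k₂ + (c + k₁))) + (P′ + suc v * o) ≡ (t * c + P′) + (t * (k₁ + (k₂ + k₁)) + o + v * o)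
        e₁ = solve-∀
        e₂ : ∀ P A t k₁ k₂ o v → (P + A) + (t * (k₁ + (k₂ + k₁)) + o + v * o) ≡ (P + v * o) + (t * (k₁ + (k₂ + k₁)) + A + o)
        e₂ = solve-∀

    step-overflows : ∀ {i st} bs p X st₁ c → length bs ≡ T → decodeBits (st counter) ≡ bs → TopOK p st → p + counterValue bs ≡ i →
                     IncrementOK bs p st (inj₂ X , st₁ , c) →
                     Invariant (suc i) (committed (inj₂ X) st₁) ×
                     2 ^ T * (width counter + (width (column 0) + (c + overflowCost))) + storedPotential (committed (inj₂ X) st₁)
                       ≤ storedPotential st + amortisedCost
    step-overflows {i} {st} bs p X st₁ c refl decoded top position (unchanged , X≡ , full , amortised) =
      (replicate T false , p + 2 ^ T , length-replicate T , decoded′ , top′ , BitsOK-zeros T columns-ok , position′) ,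
      subst (λ q → 2 ^ T * (wᶜ + (w₀ + (c + overflowCost))) + q ≤ storedPotential st + amortisedCost) (sym potential′)
        (subst (λ q → 2 ^ T * (wᶜ + (w₀ + (c + overflowCost))) + 0 ≤ counterPotential q + amortisedCost) (sym decoded)
          (accounting (2 ^ T) wᶜ w₀ c (potential bs) (creditBelow T) overflowCost (counterValue bs) amortised full))
      where
      wᶜ = width counter
      w₀ = width (column 0)
      E = decodeColumn T (st₁ (column T))
      E′ = advance E X
      st₂ = afterStoreColumns T E′ st₁
      v = encodeBits (replicate T false) % capacity counter
      decoded′ : decodeBits (committed (inj₂ X) st₁ counter) ≡ replicate T false
      decoded′ = trans (cong decodeBits (setReg-same st₂ counter v)) (decodeBits-encode (replicate T false) (length-replicate T) counter-fits)
      potential′ : storedPotential (committed (inj₂ X) st₁) ≡ 0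
      potential′ = trans (cong counterPotential decoded′) counterPotential-zeros
      same-column : ∀ k → committed (inj₂ X) st₁ (column k) ≡ st₂ (column k)
      same-column k = setReg-other st₂ counter v (λ ())
      forever : Represents∞ E′ (prefix (p + 2 ^ T))
      forever = subst (Represents∞ E′) (trans (cong (prefix p ++_) X≡) (prefix-++ p (2 ^ T)))
                  (Represents∞-advance E (prefix p) X (subst (λ x → Represents∞ (decodeColumn T x) (prefix p)) (sym (proj₁ (unchanged ≤-refl))) top))
      cheap : E′ 0 + n ≤ 2 ^ T + 2 ^ T
      cheap = subst (λ z → z + n ≤ 2 ^ T + 2 ^ T) (sym (advance-at-0 E X)) (≤-trans n≤2^T (m≤m+n _ _))
      top′ : TopOK (p + 2 ^ T) (committed (inj₂ X) st₁)
      top′ = subst (λ x → Represents∞ x (prefix (p + 2 ^ T)))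
               (sym (trans (cong (decodeColumn T) (same-column T)) (decodeColumn-afterStore T E′ st₁ (advance-at-n E X) ≤-refl ≤-refl)))
               (Represents∞-decode (2 ^ T) E′ _ cheap forever)
      columns-ok : ∀ {k} → k ≤ T → ColumnOK k (p + 2 ^ T) (committed (inj₂ X) st₁)
      columns-ok {k} k≤T = ColumnOK-cong {k} {p + 2 ^ T} {st₂} {committed (inj₂ X) st₁} (same-column k)
        (columns-ok-after-store T E′ (prefix (p + 2 ^ T)) (advance-at-n E X) ≤-refl refl (λ _ Y _ → forever Y) k≤T)
      position′ : p + 2 ^ T + counterValue (replicate T false) ≡ suc i
      position′ = begin
        p + 2 ^ T + counterValue (replicate T false) ≡⟨ cong (p + 2 ^ T +_) (counterValue-zeros T) ⟩
        p + 2 ^ T + 0                                ≡⟨ +-identityʳ _ ⟩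
        p + 2 ^ T                                    ≡⟨ cong (p +_) full ⟨
        p + suc (counterValue bs)                    ≡⟨ +-suc p _ ⟩
        suc (p + counterValue bs)                    ≡⟨ cong suc position ⟩
        suc i                                        ∎
        where open ≡-Reasoning
      accounting : ∀ t k₁ k₂ c P A o v → t * c ≤ P + A → suc v ≡ t →
                   t * (k₁ + (k₂ + (c + o))) + 0 ≤ (P + v * o) + (t * (k₁ + (k₂ + k₁)) + A + o)
      accounting t k₁ k₂ c P A o v h full = begin
        t * (k₁ + (k₂ + (c + o))) + 0                ≡⟨ e₁ t k₁ k₂ c o ⟩
        t * c + (t * (k₁ + k₂) + t * o)              ≡⟨ cong (λ u → t * c + (t * (k₁ + k₂) + u * o)) full ⟨
        t * c + (t * (k₁ + k₂) + suc v * o)          ≤⟨ +-monoˡ-≤ _ h ⟩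
        (P + A) + (t * (k₁ + k₂) + suc v * o)        ≤⟨ +-monoʳ-≤ (P + A) (+-monoˡ-≤ (suc v * o) (*-monoʳ-≤ t (+-monoʳ-≤ k₁ (m≤m+n k₂ k₁)))) ⟩
        (P + A) + (t * (k₁ + (k₂ + k₁)) + suc v * o) ≡⟨ e₂ P A t (k₁ + (k₂ + k₁)) v o ⟩
        (P + v * o) + (t * (k₁ + (k₂ + k₁)) + A + o) ∎
        where
        open ≤-Reasoning
        e₁ : ∀ t k₁ k₂ c o → t * (k₁ + (k₂ + (c + o))) + 0 ≡ t * c + (t * (k₁ + k₂) + t * o)
        e₁ = solve-∀
        e₂ : ∀ P A t K v o → (P + A) + (t * K + suc v * o) ≡ (P + v * o) + (t * K + A + o)
        e₂ = solve-∀

    StepOK : ℕ → Registers → ℕ × Registers × ℕ → Set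
    StepOK i st (o , st′ , c) = o ≡ answer i × Invariant (suc i) st′ × 2 ^ T * c + storedPotential st′ ≤ storedPotential st + amortisedCost

    step-correct : ∀ i st → Invariant i st → StepOK i st (run (onArrival (S′ i)) st)
    step-correct i st (bs , p , len , decoded , top , ok , position) =
      subst (StepOK i st) (sym (run-onArrival (S′ i) st))
        (subst (λ b → StepOK i st (arrival (S′ i) st (run (increment b (S′ i)) st))) (sym decoded)
          (cases (run (increment bs (S′ i)) st) (increment-correct bs (≤-reflexive len) ok (cong S′ (sym position)))))
      where
      cases : ∀ t → IncrementOK bs p st t → StepOK i st (arrival (S′ i) st t)
      cases (inj₁ bs′ , st₁ , c) inc = output-correct {i} {st} bs p ok position , step-keeps {i} {st} bs p bs′ st₁ c len decoded top position inc
      cases (inj₂ X   , st₁ , c) inc = output-correct {i} {st} bs p ok position , step-overflows {i} {st} bs p X st₁ c len decoded top position inc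

    initialRegisters : Registers
    initialRegisters = proj₁ (proj₂ (run preprocess (λ _ → 0)))

    initialRegisters≡ : initialRegisters ≡ afterStoreColumns T initial (λ _ → 0)
    initialRegisters≡ = cong (λ t → proj₁ (proj₂ t)) (run-storeColumns T initial (return tt) (λ _ → 0))

    decodeBits-0 : ∀ m → map (_≡ᵇ 1) (unpack 2 m 0) ≡ replicate m false
    decodeBits-0 zero    = refl
    decodeBits-0 (suc m) = cong (false ∷_) (decodeBits-0 m)

    counter-initial : decodeBits (initialRegisters counter) ≡ replicate T false
    counter-initial = trans (cong (λ st → decodeBits (st counter)) initialRegisters≡)
                            (trans (cong decodeBits (afterStoreColumns-other T initial (λ _ → 0) (λ _ ()))) (decodeBits-0 T))

    invariant-initial : Invariant 0 initialRegisters
    invariant-initial =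
      replicate T false , 0 , length-replicate T , counter-initial , top , BitsOK-zeros T columns-ok , counterValue-zeros T
      where
      decoded : ∀ {k} → k ≤ T → decodeColumn k (initialRegisters (column k)) ≡ decode (code (2 ^ k) initial)
      decoded {k} k≤T = trans (cong (λ st → decodeColumn k (st (column k))) initialRegisters≡)
                          (decodeColumn-afterStore T initial (λ _ → 0) ≤-refl ≤-refl k≤T)
      top : TopOK 0 initialRegisters
      top = subst (λ E → Represents∞ E []) (sym (decoded ≤-refl))
              (Represents∞-decode (2 ^ T) initial [] (≤-trans n≤2^T (m≤m+n _ _)) (λ _ → refl))
      columns-ok : ∀ {k} → k ≤ T → ColumnOK k 0 initialRegisters
      columns-ok {k} k≤T = subst (λ E → Represents (2 ^ k) E []) (sym (decoded k≤T))
                             (Represents-decode (2 ^ k) initial [] (λ _ _ → refl))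

    registersAt : ℕ → Registers
    registersAt zero    = initialRegisters
    registersAt (suc i) = proj₁ (proj₂ (run (onArrival (S′ i)) (registersAt i)))

    costAt : ℕ → ℕ
    costAt i = proj₂ (proj₂ (run (onArrival (S′ i)) (registersAt i)))

    invariant-at : ∀ i → Invariant i (registersAt i)
    invariant-at zero    = invariant-initial
    invariant-at (suc i) = proj₁ (proj₂ (step-correct i (registersAt i) (invariant-at i)))

    output-at : ∀ i → proj₁ (run (onArrival (S′ i)) (registersAt i)) ≡ answer i
    output-at i = proj₁ (step-correct i (registersAt i) (invariant-at i))

    totalCost : ℕ → ℕ
    totalCost zero    = 0
    totalCost (suc t) = totalCost t + costAt t

    totalCost-amortised : ∀ t → 2 ^ T * totalCost t + storedPotential (registersAt t) ≤ t * amortisedCost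
    totalCost-amortised zero    = ≤-reflexive (cong₂ _+_ (*-zeroʳ (2 ^ T)) (trans (cong counterPotential counter-initial) counterPotential-zeros))
    totalCost-amortised (suc t) = begin
      2 ^ T * (totalCost t + costAt t) + storedPotential (registersAt (suc t))  ≡⟨ regroup (2 ^ T) (totalCost t) (costAt t) _ ⟩
      2 ^ T * totalCost t + (2 ^ T * costAt t + storedPotential (registersAt (suc t)))
        ≤⟨ +-monoʳ-≤ (2 ^ T * totalCost t) (proj₂ (proj₂ (step-correct t (registersAt t) (invariant-at t)))) ⟩
      2 ^ T * totalCost t + (storedPotential (registersAt t) + amortisedCost)  ≡⟨ +-assoc (2 ^ T * totalCost t) _ _ ⟨
      2 ^ T * totalCost t + storedPotential (registersAt t) + amortisedCost    ≤⟨ +-monoˡ-≤ amortisedCost (totalCost-amortised t) ⟩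
      t * amortisedCost + amortisedCost                                        ≡⟨ +-comm (t * amortisedCost) amortisedCost ⟩
      suc t * amortisedCost                                                    ∎
      where
      open ≤-Reasoning
      regroup : ∀ a b c d → a * (b + c) + d ≡ a * b + (a * c + d)
      regroup = solve-∀

  module CostBound (U : ℕ)
    (column-width  : ∀ k → w * width (column k) ≤ U * 2 ^ k + w)
    (block-width   : ∀ k → w * width (block k) ≤ U * 2 ^ k + w)
    (counter-width : w * width counter ≤ U + w) where

    storeColumnsCost-bound : ∀ ℓ → w * storeColumnsCost ℓ ≤ U * 2 ^ suc ℓ + suc ℓ * w
    storeColumnsCost-bound zero    = ≤-trans (column-width 0) (+-mono-≤ (*-monoʳ-≤ U (s≤s z≤n)) (≤-reflexive (sym (+-identityʳ w))))
    storeColumnsCost-bound (suc ℓ) = begin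
      w * (width (column (suc ℓ)) + storeColumnsCost ℓ)    ≡⟨ *-distribˡ-+ w _ _ ⟩
      w * width (column (suc ℓ)) + w * storeColumnsCost ℓ  ≤⟨ +-mono-≤ (column-width (suc ℓ)) (storeColumnsCost-bound ℓ) ⟩
      (U * 2 ^ suc ℓ + w) + (U * 2 ^ suc ℓ + suc ℓ * w)    ≡⟨ regroup U (2 ^ suc ℓ) w ℓ ⟩
      U * 2 ^ suc (suc ℓ) + suc (suc ℓ) * w                ∎
      where
      open ≤-Reasoning
      regroup : ∀ U p w ℓ → (U * p + w) + (U * p + suc ℓ * w) ≡ U * (2 * p) + suc (suc ℓ) * w
      regroup = solve-∀

    carryCost-bound : ∀ ℓ → w * (zeroBitCost ℓ + blockCost ℓ) ≤ U * (6 * 2 ^ ℓ) + (ℓ + 4) * w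
    carryCost-bound ℓ = begin
      w * (zeroBitCost ℓ + blockCost ℓ)
        ≡⟨ distribute w (width (block ℓ)) (width (column (suc ℓ))) (storeColumnsCost ℓ) ⟩
      w * width (block ℓ) + w * width (column (suc ℓ)) + w * storeColumnsCost ℓ + w * width (block ℓ)
        ≤⟨ +-mono-≤ (+-mono-≤ (+-mono-≤ (block-width ℓ) (column-width (suc ℓ))) (storeColumnsCost-bound ℓ)) (block-width ℓ) ⟩
      (U * 2 ^ ℓ + w) + (U * 2 ^ suc ℓ + w) + (U * 2 ^ suc ℓ + suc ℓ * w) + (U * 2 ^ ℓ + w)
        ≡⟨ regroup U (2 ^ ℓ) w ℓ ⟩
      U * (6 * 2 ^ ℓ) + (ℓ + 4) * w ∎
      where
      open ≤-Reasoning
      distribute : ∀ w a b c → w * (a + (b + (c + 0)) + a) ≡ w * a + w * b + w * c + w * a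
      distribute = solve-∀
      regroup : ∀ U p w ℓ → (U * p + w) + (U * (2 * p) + w) + (U * (2 * p) + suc ℓ * w) + (U * p + w) ≡ U * (6 * p) + (ℓ + 4) * w
      regroup = solve-∀

    levelCredit-bound : ∀ {ℓ} → ℓ ≤ T → w * levelCredit ℓ ≤ 6 * U * 2 ^ T + 2 ^ (T ∸ ℓ) * ((ℓ + 4) * w)
    levelCredit-bound {ℓ} ℓ≤T = begin
      w * (2 ^ (T ∸ ℓ) * (zeroBitCost ℓ + blockCost ℓ))            ≡⟨ swap w (2 ^ (T ∸ ℓ)) (zeroBitCost ℓ + blockCost ℓ) ⟩
      2 ^ (T ∸ ℓ) * (w * (zeroBitCost ℓ + blockCost ℓ))            ≤⟨ *-monoʳ-≤ (2 ^ (T ∸ ℓ)) (carryCost-bound ℓ) ⟩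
      2 ^ (T ∸ ℓ) * (U * (6 * 2 ^ ℓ) + (ℓ + 4) * w)                ≡⟨ regroup (2 ^ (T ∸ ℓ)) U (2 ^ ℓ) ((ℓ + 4) * w) ⟩
      6 * U * (2 ^ (T ∸ ℓ) * 2 ^ ℓ) + 2 ^ (T ∸ ℓ) * ((ℓ + 4) * w)  ≡⟨ cong (λ t → 6 * U * t + 2 ^ (T ∸ ℓ) * ((ℓ + 4) * w)) (m^[n∸o]*m^o≡m^n 2 ℓ≤T) ⟩
      6 * U * 2 ^ T + 2 ^ (T ∸ ℓ) * ((ℓ + 4) * w)                  ∎
      where
      open ≤-Reasoning
      swap : ∀ w a b → w * (a * b) ≡ a * (w * b)
      swap = solve-∀
      regroup : ∀ a U p x → a * (U * (6 * p) + x) ≡ 6 * U * (a * p) + a * x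
      regroup = solve-∀

    -- The slack 2^(T ∸ m) (2m + 10) w absorbs the word-rounding terms, because Σ_ℓ (ℓ + 4) / 2^ℓ ≤ 10.
    creditBelow-bound : ∀ {m} → m ≤ T → w * creditBelow m + 2 ^ (T ∸ m) * ((m + m + 10) * w) ≤ 6 * U * m * 2 ^ T + 10 * 2 ^ T * w
    creditBelow-bound {zero}  _   = ≤-reflexive (empty (2 ^ T) w U)
      where
      empty : ∀ p w U → w * 0 + p * (10 * w) ≡ 6 * U * 0 * p + 10 * p * w
      empty = solve-∀
    creditBelow-bound {suc m} m<T = begin
      w * (creditBelow m + levelCredit m) + q * ((suc m + suc m + 10) * w)
        ≡⟨ distribute w (creditBelow m) (levelCredit m) q m ⟩
      w * creditBelow m + w * levelCredit m + q * ((m + m + 12) * w)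
        ≤⟨ +-monoˡ-≤ _ (+-monoʳ-≤ (w * creditBelow m) (levelCredit-bound (<⇒≤ m<T))) ⟩
      w * creditBelow m + (6 * U * 2 ^ T + 2 ^ (T ∸ m) * ((m + 4) * w)) + q * ((m + m + 12) * w)
        ≡⟨ cong (λ t → w * creditBelow m + (6 * U * 2 ^ T + t * ((m + 4) * w)) + q * ((m + m + 12) * w)) halve ⟩
      w * creditBelow m + (6 * U * 2 ^ T + 2 * q * ((m + 4) * w)) + q * ((m + m + 12) * w)
        ≡⟨ regroup (w * creditBelow m) (6 * U * 2 ^ T) q m w ⟩
      w * creditBelow m + 2 * q * ((m + m + 10) * w) + 6 * U * 2 ^ T
        ≡⟨ cong (λ t → w * creditBelow m + t * ((m + m + 10) * w) + 6 * U * 2 ^ T) halve ⟨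
      w * creditBelow m + 2 ^ (T ∸ m) * ((m + m + 10) * w) + 6 * U * 2 ^ T
        ≤⟨ +-monoˡ-≤ _ (creditBelow-bound (<⇒≤ m<T)) ⟩
      6 * U * m * 2 ^ T + 10 * 2 ^ T * w + 6 * U * 2 ^ T
        ≡⟨ collect U m (2 ^ T) w ⟩
      6 * U * suc m * 2 ^ T + 10 * 2 ^ T * w ∎
      where
      open ≤-Reasoning
      q = 2 ^ (T ∸ suc m)
      halve : 2 ^ (T ∸ m) ≡ 2 * q
      halve = cong (2 ^_) (+-∸-assoc 1 m<T)
      distribute : ∀ w a b q m → w * (a + b) + q * ((suc m + suc m + 10) * w) ≡ w * a + w * b + q * ((m + m + 12) * w)
      distribute = solve-∀
      regroup : ∀ A B q m w → A + (B + 2 * q * ((m + 4) * w)) + q * ((m + m + 12) * w) ≡ A + 2 * q * ((m + m + 10) * w) + B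
      regroup = solve-∀
      collect : ∀ U m p w → 6 * U * m * p + 10 * p * w + 6 * U * p ≡ 6 * U * suc m * p + 10 * p * w
      collect = solve-∀

    fixedCost-bound : w * fixedCost ≤ 3 * (U + w)
    fixedCost-bound = begin
      w * fixedCost                                                       ≡⟨ *-distribˡ-+ w (width counter) _ ⟩
      w * width counter + w * (width (column 0) + width counter)          ≡⟨ cong (w * width counter +_) (*-distribˡ-+ w (width (column 0)) _) ⟩
      w * width counter + (w * width (column 0) + w * width counter)      ≤⟨ +-mono-≤ counter-width (+-mono-≤ (column-width 0) counter-width) ⟩
      (U + w) + ((U * 1 + w) + (U + w))                                   ≡⟨ regroup U w ⟩
      3 * (U + w)                                                         ∎
      where
      open ≤-Reasoning
      regroup : ∀ U w → (U + w) + ((U * 1 + w) + (U + w)) ≡ 3 * (U + w)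
      regroup = solve-∀

    overflowCost-bound : w * overflowCost ≤ 2 ^ T * (4 * U + 3 * w)
    overflowCost-bound = begin
      w * overflowCost
        ≡⟨ distribute w (width (column T)) (storeColumnsCost T) (width counter) ⟩
      w * width (column T) + w * storeColumnsCost T + w * width counter
        ≤⟨ +-mono-≤ (+-mono-≤ (column-width T) (storeColumnsCost-bound T)) counter-width ⟩
      (U * p + w) + (U * (2 * p) + suc T * w) + (U + w)
        ≡⟨ regroup U p w T ⟩
      U * (3 * p + 1) + (T + 3) * w
        ≤⟨ +-mono-≤ (*-monoʳ-≤ U (+-monoʳ-≤ (3 * p) (m^n>0 2 T))) (*-monoˡ-≤ w T+3≤3p) ⟩
      U * (3 * p + p) + 3 * p * w
        ≡⟨ collect U p w ⟩
      p * (4 * U + 3 * w) ∎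
      where
      open ≤-Reasoning
      p = 2 ^ T
      T+3≤3p : T + 3 ≤ 3 * p
      T+3≤3p = begin
        T + 3      ≡⟨ +-comm T 3 ⟩
        2 + suc T  ≤⟨ +-mono-≤ (*-monoʳ-≤ 2 (m^n>0 2 T)) (n<2^n T) ⟩
        2 * p + p  ≡⟨ +-comm (2 * p) p ⟩
        3 * p      ∎
      distribute : ∀ w a b c → w * (a + (b + (c + 0))) ≡ w * a + w * b + w * c
      distribute = solve-∀
      regroup : ∀ U p w T → (U * p + w) + (U * (2 * p) + suc T * w) + (U + w) ≡ U * (3 * p + 1) + (T + 3) * w
      regroup = solve-∀
      collect : ∀ U p w → U * (3 * p + p) + 3 * p * w ≡ p * (4 * U + 3 * w)
      collect = solve-∀

    amortisedCost-bound : w * amortisedCost ≤ 2 ^ T * (U * (7 + 6 * T) + 16 * w)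
    amortisedCost-bound = begin
      w * (2 ^ T * fixedCost + creditBelow T + overflowCost)
        ≡⟨ distribute w (2 ^ T) fixedCost (creditBelow T) overflowCost ⟩
      2 ^ T * (w * fixedCost) + w * creditBelow T + w * overflowCost
        ≤⟨ +-mono-≤ (+-mono-≤ (*-monoʳ-≤ (2 ^ T) fixedCost-bound) (m+n≤o⇒m≤o _ (creditBelow-bound ≤-refl))) overflowCost-bound ⟩
      2 ^ T * (3 * (U + w)) + (6 * U * T * 2 ^ T + 10 * 2 ^ T * w) + 2 ^ T * (4 * U + 3 * w)
        ≡⟨ collect (2 ^ T) U w T ⟩
      2 ^ T * (U * (7 + 6 * T) + 16 * w) ∎
      where
      open ≤-Reasoning
      distribute : ∀ w p F A O → w * (p * F + A + O) ≡ p * (w * F) + w * A + w * O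
      distribute = solve-∀
      collect : ∀ p U w T → p * (3 * (U + w)) + (6 * U * T * p + 10 * p * w) + p * (4 * U + 3 * w) ≡ p * (U * (7 + 6 * T) + 16 * w)
      collect = solve-∀

segFrom-toℕ : ∀ {σ} (S : ℕ → Fin σ) h l → map toℕ (segFrom S h l) ≡ segment (λ j → toℕ (S j)) h (suc l)
segFrom-toℕ S h zero    = refl
segFrom-toℕ S h (suc l) = cong (toℕ (S h) ∷_) (segFrom-toℕ S (suc h) l)

length-segFrom : ∀ {σ} (S : ℕ → Fin σ) h l → length (segFrom S h l) ≡ suc l
length-segFrom S h zero    = refl
length-segFrom S h (suc l) = cong suc (length-segFrom S (suc h) l)

drop-segment : ∀ f h l k → drop k (segment f h l) ≡ segment f (h + k) (l ∸ k)
drop-segment f h l       zero    = cong (λ t → segment f t l) (sym (+-identityʳ h))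
drop-segment f h zero    (suc k) = refl
drop-segment f h (suc l) (suc k) = trans (drop-segment f (suc h) l k) (cong (λ t → segment f t (l ∸ k)) (sym (+-suc h k)))

module _ {σ : ℕ} (F : List (Fin σ)) (S : ℕ → Fin σ) (F≢[] : 1 ≤ length F) where
  private
    module EF = EditDistance (Data.Fin._≟_ {σ})
    module EN = EditDistance _≟_
    Fₙ = map toℕ F
    Sₙ : ℕ → ℕ
    Sₙ j = toℕ (S j)

  ed-segFrom : ∀ h l → EF.ed F (segFrom S h l) ≡ EN.ed Fₙ (segment Sₙ h (suc l))
  ed-segFrom h l = trans (ed-map Data.Fin._≟_ Data.Nat._≟_ toℕ-injective F (segFrom S h l)) (cong (EN.ed Fₙ) (segFrom-toℕ S h l))

  minSuffix-IsOnlineAnswer : ∀ i → IsOnlineAnswer F S i (minSuffix (EN.ed Fₙ) (segment Sₙ 0 (suc i)))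
  minSuffix-IsOnlineAnswer i = attained (minSuffix-attained (EN.ed Fₙ) Y) , least
    where
    Y = segment Sₙ 0 (suc i)
    a = minSuffix (EN.ed Fₙ) Y
    suffix : ∀ {h l} → h + l ≡ i → drop h Y ≡ segment Sₙ h (suc l)
    suffix {h} {l} h+l≡i = trans (drop-segment Sₙ 0 (suc i) h) (cong (segment Sₙ h) (begin
      suc i ∸ h        ≡⟨ cong (λ t → suc t ∸ h) h+l≡i ⟨
      suc (h + l) ∸ h  ≡⟨ cong (_∸ h) (+-suc h l) ⟨
      h + suc l ∸ h    ≡⟨ m+n∸m≡n h (suc l) ⟩
      suc l            ∎))
      where open ≡-Reasoning
    least : ∀ h l k → h + l ≡ i → EditsIn F (segFrom S h l) k → a ≤ k
    least h l k h+l≡i edits = begin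
      a                                   ≤⟨ minSuffix-≤ (EN.ed Fₙ) Y h ⟩
      EN.ed Fₙ (drop h Y)                 ≡⟨ cong (EN.ed Fₙ) (suffix h+l≡i) ⟩
      EN.ed Fₙ (segment Sₙ h (suc l))     ≡⟨ ed-segFrom h l ⟨
      EF.ed F (segFrom S h l)             ≤⟨ EF.ed≤EditsIn edits ⟩
      k                                   ∎
      where open ≤-Reasoning
    witness : ∀ h l → h + l ≡ i → EF.ed F (segFrom S h l) ≡ a → ∃[ h ] ∃[ l ] (h + l ≡ i × EditsIn F (segFrom S h l) a)
    witness h l h+l≡i eq = h , l , h+l≡i , subst (EditsIn F (segFrom S h l)) eq (EF.EditsIn-ed F (segFrom S h l))
    attained : Σ[ k ∈ ℕ ] (a ≡ EN.ed Fₙ (drop k Y)) → ∃[ h ] ∃[ l ] (h + l ≡ i × EditsIn F (segFrom S h l) a)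
    attained (k , a≡) with k ≤? i
    ... | yes k≤i = witness k (i ∸ k) (m+[n∸m]≡n k≤i)
                      (trans (ed-segFrom k (i ∸ k)) (sym (trans a≡ (cong (EN.ed Fₙ) (suffix (m+[n∸m]≡n k≤i))))))
    ... | no  k≰i = witness i 0 (+-identityʳ i) (trans (ed-segFrom i 0) (≤-antisym last≤a a≤last))
      where
      a≤last : a ≤ EN.ed Fₙ (segment Sₙ i 1)
      a≤last = ≤-trans (minSuffix-≤ (EN.ed Fₙ) Y i) (≤-reflexive (cong (EN.ed Fₙ) (suffix (+-identityʳ i))))
      a≡n : a ≡ length Fₙ
      a≡n = trans a≡ (trans (cong (EN.ed Fₙ) (drop-all k Y (≤-trans (≤-reflexive (length-segment Sₙ 0 (suc i))) (≰⇒> k≰i)))) (EN.ed-[]ʳ Fₙ))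
      last≤a : EN.ed Fₙ (segment Sₙ i 1) ≤ a
      last≤a = ≤-trans (EN.ed-singleton Fₙ (Sₙ i) (subst (1 ≤_) (sym (length-map toℕ F)) F≢[])) (≤-reflexive (sym a≡n))

wordsFor : ℕ → ℕ → ℕ
wordsFor w′ b = (b + w′) / suc w′

module _ (w′ : ℕ) where
  private
    w = suc w′

  wordsFor-≥ : ∀ b → b ≤ w * wordsFor w′ b
  wordsFor-≥ b = +-cancelʳ-≤ w′ b (w * wordsFor w′ b) (begin
    b + w′                                 ≡⟨ m≡m%n+[m/n]*n (b + w′) w ⟩
    (b + w′) % w + wordsFor w′ b * w       ≤⟨ +-monoˡ-≤ (wordsFor w′ b * w) (s≤s⁻¹ (m%n<n (b + w′) w)) ⟩
    w′ + wordsFor w′ b * w                 ≡⟨ +-comm w′ _ ⟩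
    wordsFor w′ b * w + w′                 ≡⟨ cong (_+ w′) (*-comm (wordsFor w′ b) w) ⟩
    w * wordsFor w′ b + w′                 ∎)
    where open ≤-Reasoning

  wordsFor-≤ : ∀ b → w * wordsFor w′ b ≤ b + w
  wordsFor-≤ b = begin
    w * wordsFor w′ b  ≡⟨ *-comm w (wordsFor w′ b) ⟩
    wordsFor w′ b * w  ≤⟨ m/n*n≤m (b + w′) w ⟩
    b + w′             ≤⟨ +-monoʳ-≤ b (n≤1+n w′) ⟩
    b + w              ∎
    where open ≤-Reasoning

  2^≤wordsFor : ∀ b → 2 ^ b ≤ (2 ^ w) ^ wordsFor w′ b
  2^≤wordsFor b = ≤-trans (^-monoʳ-≤ 2 (wordsFor-≥ b)) (≤-reflexive (sym (^-*-assoc 2 w (wordsFor w′ b))))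

1+σ≤2^[d+T*c] : ∀ c d n T σ → n ≤ 2 ^ T → σ ≤ d * n ^ c → suc σ ≤ 2 ^ (d + T * c)
1+σ≤2^[d+T*c] c d n T σ nT σ≤ = begin
  suc σ ≤⟨ s≤s σ≤ ⟩
  suc (d * n ^ c) ≤⟨ s≤s (*-monoʳ-≤ d (^-monoˡ-≤ c nT)) ⟩
  suc (d * (2 ^ T) ^ c) ≡⟨ cong (λ t → suc (d * t)) (^-*-assoc 2 T c) ⟩
  suc (d * y) ≤⟨ +-monoˡ-≤ (d * y) (m^n>0 2 (T * c)) ⟩
  y + d * y ≤⟨ *-monoˡ-≤ y (n<2^n d) ⟩
  2 ^ d * y ≡⟨ sym (^-distribˡ-+-* 2 d (T * c)) ⟩
  2 ^ (d + T * c) ∎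
  where
  open ≤-Reasoning
  y = 2 ^ (T * c)

[1+T]²≤2[T²+w] : ∀ T w → 1 ≤ w → suc T * suc T ≤ 2 * (T * T + w)
[1+T]²≤2[T²+w] T w w≥ = begin
  suc T * suc T ≡⟨ e T ⟩
  T * T + (T + T) + 1 ≤⟨ +-mono-≤ (+-monoʳ-≤ (T * T) (m+m≤m*m+1 T)) w≥ ⟩
  T * T + (T * T + 1) + w ≤⟨ +-monoˡ-≤ w (+-monoʳ-≤ (T * T) (+-monoʳ-≤ (T * T) w≥)) ⟩
  T * T + (T * T + w) + w ≡⟨ e2 T w ⟩
  2 * (T * T + w) ∎
  where
  open ≤-Reasoning
  e : ∀ T → suc T * suc T ≡ T * T + (T + T) + 1
  e = solve-∀
  e2 : ∀ T w → T * T + (T * T + w) + w ≡ 2 * (T * T + w)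
  e2 = solve-∀
  m+m≤m*m+1 : ∀ T → T + T ≤ T * T + 1
  m+m≤m*m+1 zero = z≤n
  m+m≤m*m+1 (suc k) = begin
    suc k + suc k ≡⟨ e3 k ⟩
    k + k + 2 ≤⟨ +-monoˡ-≤ 2 (+-monoʳ-≤ k (m≤m*n k (suc k))) ⟩
    k + k * suc k + 2 ≡⟨ e4 k ⟩
    suc k * suc k + 1 ∎
    where
    e3 : ∀ k → suc k + suc k ≡ k + k + 2
    e3 = solve-∀
    e4 : ∀ k → k + k * suc k + 2 ≡ suc k * suc k + 1
    e4 = solve-∀

amortisedCost-arith : ∀ c d T w → 1 ≤ w → 3 * (suc T + (d + T * c)) * (7 + 6 * T) + 16 * w ≤ 58 * (c + d + 1) * (w + T ^ 2)
amortisedCost-arith c d T w 1≤w = begin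
  3 * (suc T + (d + T * c)) * (7 + 6 * T) + 16 * w      ≤⟨ +-monoˡ-≤ (16 * w) (*-mono-≤ (*-monoʳ-≤ 3 bits≤) levels≤) ⟩
  3 * (K * suc T) * (7 * suc T) + 16 * w                ≡⟨ regroup K T w ⟩
  21 * K * (suc T * suc T) + 16 * w                     ≤⟨ +-mono-≤ (*-monoʳ-≤ (21 * K) ([1+T]²≤2[T²+w] T w 1≤w)) (*-monoʳ-≤ 16 w≤K[T²+w]) ⟩
  21 * K * (2 * (T * T + w)) + 16 * (K * (T * T + w))   ≡⟨ collect K T w ⟩
  58 * K * (w + T ^ 2)                                  ∎
  where
  open ≤-Reasoning
  K = c + d + 1
  bits≤ : suc T + (d + T * c) ≤ K * suc T
  bits≤ = ≤-trans (m≤m+n _ (c + d * T)) (≤-reflexive (expand c d T))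
    where
    expand : ∀ c d T → suc T + (d + T * c) + (c + d * T) ≡ (c + d + 1) * suc T
    expand = solve-∀
  levels≤ : 7 + 6 * T ≤ 7 * suc T
  levels≤ = ≤-trans (m≤m+n (7 + 6 * T) T) (≤-reflexive (expand T))
    where
    expand : ∀ T → 7 + 6 * T + T ≡ 7 * suc T
    expand = solve-∀
  w≤K[T²+w] : w ≤ K * (T * T + w)
  w≤K[T²+w] = begin
    w                  ≤⟨ m≤n+m w (T * T) ⟩
    T * T + w          ≡⟨ *-identityˡ (T * T + w) ⟨
    1 * (T * T + w)    ≤⟨ *-monoˡ-≤ (T * T + w) (m≤n+m 1 (c + d)) ⟩
    K * (T * T + w)    ∎
  regroup : ∀ K T w → 3 * (K * suc T) * (7 * suc T) + 16 * w ≡ 21 * K * (suc T * suc T) + 16 * w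
  regroup = solve-∀
  collect : ∀ K T w → 21 * K * (2 * (T * T + w)) + 16 * (K * (T * T + w)) ≡ 58 * K * (w + T * (T * 1))
  collect = solve-∀

n≤2^⌈log₂n⌉ : ∀ n → n ≤ 2 ^ ⌈log₂ n ⌉
n≤2^⌈log₂n⌉ n = go n (<-wellFounded n)
  where
  go : ∀ n (acc : Acc _<_ n) → n ≤ 2 ^ ⌈log2⌉ n acc
  go zero          _         = z≤n
  go (suc zero)    _         = ≤-refl
  go (suc (suc n)) (acc rec) = begin
    suc (suc n)                       ≤⟨ s≤s (s≤s n≤⌈n/2⌉+⌈n/2⌉) ⟩
    suc (suc (⌈ n /2⌉ + ⌈ n /2⌉))     ≡⟨ cong suc (+-suc ⌈ n /2⌉ ⌈ n /2⌉) ⟨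
    suc ⌈ n /2⌉ + suc ⌈ n /2⌉         ≤⟨ +-mono-≤ half half ⟩
    2 ^ L + 2 ^ L                     ≡⟨ cong (2 ^ L +_) (+-identityʳ (2 ^ L)) ⟨
    2 ^ suc L                         ∎
    where
    open ≤-Reasoning
    L = ⌈log2⌉ (suc ⌈ n /2⌉) (rec (⌈n/2⌉<n n))
    half : suc ⌈ n /2⌉ ≤ 2 ^ L
    half = go (suc ⌈ n /2⌉) (rec (⌈n/2⌉<n n))
    n≤⌈n/2⌉+⌈n/2⌉ : n ≤ ⌈ n /2⌉ + ⌈ n /2⌉
    n≤⌈n/2⌉+⌈n/2⌉ = ≤-trans (≤-reflexive (sym (⌊n/2⌋+⌈n/2⌉≡n n))) (+-monoˡ-≤ ⌈ n /2⌉ (⌊n/2⌋≤⌈n/2⌉ n))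

module Construction (c d n w′ σ : ℕ) (σ≤ : σ ≤ d * suc n ^ c) (F : Vec (Fin σ) (suc n)) where
  w T D U : ℕ
  w = suc w′
  T = ⌈log₂ suc n ⌉
  D = d + T * c
  U = 3 * (suc T + D)

  width : Reg → ℕ
  width counter    = wordsFor w′ T
  width (column k) = wordsFor w′ (suc T * suc (2 ^ k + 2 ^ k))
  width (block k)  = wordsFor w′ (D * 2 ^ k)

  open Algorithm w width σ (map toℕ (toList F)) T renaming (n to |F|)

  |F|≡ : |F| ≡ suc n
  |F|≡ = trans (length-map toℕ (toList F)) (length-toList F)

  |F|≤2^T : |F| ≤ 2 ^ T
  |F|≤2^T = subst (_≤ 2 ^ T) (sym |F|≡) (n≤2^⌈log₂n⌉ (suc n))

  counter-fits : 2 ^ T ≤ capacity counter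
  counter-fits = 2^≤wordsFor w′ T

  column-fits : ∀ {k} → k ≤ T → suc |F| ^ suc (2 ^ k + 2 ^ k) ≤ capacity (column k)
  column-fits {k} _ = begin
    suc |F| ^ N          ≤⟨ ^-monoˡ-≤ N (≤-trans (s≤s |F|≤2^T) 1+2^T≤2^[1+T]) ⟩
    (2 ^ suc T) ^ N      ≡⟨ ^-*-assoc 2 (suc T) N ⟩
    2 ^ (suc T * N)      ≤⟨ 2^≤wordsFor w′ (suc T * N) ⟩
    capacity (column k)  ∎
    where
    open ≤-Reasoning
    N = suc (2 ^ k + 2 ^ k)
    1+2^T≤2^[1+T] : suc (2 ^ T) ≤ 2 ^ suc T
    1+2^T≤2^[1+T] = ≤-trans (≤-reflexive (+-comm 1 (2 ^ T))) (+-monoʳ-≤ (2 ^ T) (≤-trans (m^n>0 2 T) (m≤m+n (2 ^ T) 0)))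

  block-fits : ∀ {k} → k < T → suc σ ^ 2 ^ k ≤ capacity (block k)
  block-fits {k} _ = begin
    suc σ ^ 2 ^ k        ≤⟨ ^-monoˡ-≤ (2 ^ k) (1+σ≤2^[d+T*c] c d (suc n) T σ (n≤2^⌈log₂n⌉ (suc n)) σ≤) ⟩
    (2 ^ D) ^ 2 ^ k      ≡⟨ ^-*-assoc 2 D (2 ^ k) ⟩
    2 ^ (D * 2 ^ k)      ≤⟨ 2^≤wordsFor w′ (D * 2 ^ k) ⟩
    capacity (block k)   ∎
    where open ≤-Reasoning

  column-width : ∀ k → w * width (column k) ≤ U * 2 ^ k + w
  column-width k = begin
    w * width (column k)              ≤⟨ wordsFor-≤ w′ (suc T * suc (2 ^ k + 2 ^ k)) ⟩
    suc T * suc (2 ^ k + 2 ^ k) + w   ≤⟨ +-monoˡ-≤ w (*-monoʳ-≤ (suc T) three) ⟩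
    suc T * (3 * 2 ^ k) + w           ≡⟨ cong (_+ w) (reorder (suc T) (2 ^ k)) ⟩
    3 * suc T * 2 ^ k + w             ≤⟨ +-monoˡ-≤ w (*-monoˡ-≤ (2 ^ k) (*-monoʳ-≤ 3 (m≤m+n (suc T) D))) ⟩
    U * 2 ^ k + w                     ∎
    where
    open ≤-Reasoning
    three : suc (2 ^ k + 2 ^ k) ≤ 3 * 2 ^ k
    three = ≤-trans (≤-reflexive (+-comm 1 (2 ^ k + 2 ^ k)))
              (≤-trans (+-monoʳ-≤ (2 ^ k + 2 ^ k) (m^n>0 2 k)) (≤-reflexive (triple (2 ^ k))))
      where
      triple : ∀ p → p + p + p ≡ 3 * p
      triple = solve-∀
    reorder : ∀ a p → a * (3 * p) ≡ 3 * a * p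
    reorder = solve-∀

  D≤U : D ≤ U
  D≤U = ≤-trans (m≤n+m D (suc T)) (m≤m+n (suc T + D) _)

  block-width : ∀ k → w * width (block k) ≤ U * 2 ^ k + w
  block-width k = ≤-trans (wordsFor-≤ w′ (D * 2 ^ k)) (+-monoˡ-≤ w (*-monoˡ-≤ (2 ^ k) D≤U))

  counter-width : w * width counter ≤ U + w
  counter-width = ≤-trans (wordsFor-≤ w′ T) (+-monoˡ-≤ w (≤-trans (n≤1+n T) (≤-trans (m≤m+n (suc T) D) (m≤m+n (suc T + D) _))))

  algorithm : OnlineAlg w σ
  algorithm = record
    { initMem  = proj₁ (proj₂ (exec (compile preprocess) zeroMemory))
    ; onSymbol = λ s → compile (onArrival (toℕ s))
    }

  module _ (S : ℕ → Fin σ) where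
    open Run (λ j → toℕ (S j)) (λ j → toℕ<n (S j)) |F|≤2^T column-fits block-fits counter-fits

    simulated : ∀ i → Holds (memBefore algorithm S i) (registersAt i)
    simulated zero    = proj₁ (proj₂ (compile-simulates preprocess Holds-zero))
    simulated (suc i) = proj₁ (proj₂ (compile-simulates (onArrival (toℕ (S i))) (simulated i)))

    totalProbes≡ : ∀ t → totalProbes algorithm S t ≡ totalCost t
    totalProbes≡ zero    = refl
    totalProbes≡ (suc t) = cong₂ _+_ (totalProbes≡ t) (proj₂ (proj₂ (compile-simulates (onArrival (toℕ (S t))) (simulated t))))

    algorithm-correct : ∀ i → IsOnlineAnswer (toList F) S i (output algorithm S i)
    algorithm-correct i = subst (IsOnlineAnswer (toList F) S i)
      (sym (trans (proj₁ (compile-simulates (onArrival (toℕ (S i))) (simulated i))) (output-at i)))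
      (minSuffix-IsOnlineAnswer (toList F) S (subst (1 ≤_) (sym (length-toList F)) (s≤s z≤n)) i)

    algorithm-cost : ∀ t → w * totalProbes algorithm S t ≤ 58 * (c + d + 1) * t * (w + T ^ 2)
    algorithm-cost t = *-cancelˡ-≤ (2 ^ T) {{m^n≢0 2 T}} (begin
      2 ^ T * (w * totalProbes algorithm S t)       ≡⟨ cong (λ x → 2 ^ T * (w * x)) (totalProbes≡ t) ⟩
      2 ^ T * (w * totalCost t)                     ≡⟨ swap (2 ^ T) w (totalCost t) ⟩
      w * (2 ^ T * totalCost t)                     ≤⟨ *-monoʳ-≤ w (m+n≤o⇒m≤o (2 ^ T * totalCost t) (totalCost-amortised t)) ⟩
      w * (t * amortisedCost)                       ≡⟨ swap w t amortisedCost ⟩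
      t * (w * amortisedCost)                       ≤⟨ *-monoʳ-≤ t amortisedCost-bound ⟩
      t * (2 ^ T * (U * (7 + 6 * T) + 16 * w))      ≤⟨ *-monoʳ-≤ t (*-monoʳ-≤ (2 ^ T) (amortisedCost-arith c d T w (s≤s z≤n))) ⟩
      t * (2 ^ T * (58 * (c + d + 1) * (w + T ^ 2))) ≡⟨ reorder t (2 ^ T) (58 * (c + d + 1)) (w + T ^ 2) ⟩
      2 ^ T * (58 * (c + d + 1) * t * (w + T ^ 2))  ∎)
      where
      open ≤-Reasoning
      open CostBound U column-width block-width counter-width
      swap : ∀ a b x → a * (b * x) ≡ b * (a * x)
      swap = solve-∀
      reorder : ∀ t p C X → t * (p * (C * X)) ≡ p * (C * t * X)
      reorder = solve-∀

-- Against the empty pattern every nonempty segment costs exactly its length, so the answer is 1.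
module EmptyPattern (w σ : ℕ) where

  algorithm : OnlineAlg w σ
  algorithm = record { initMem = λ _ → fromℕ< (m^n>0 2 w) ; onSymbol = λ _ → ret 1 }

  algorithm-correct : ∀ S i → IsOnlineAnswer [] S i (output algorithm S i)
  algorithm-correct S i = (i , 0 , +-identityʳ i , step (insert [] [] (S i)) done) , λ h l k _ edits →
    ≤-trans (≤-trans (s≤s z≤n) (≤-reflexive (sym (length-segFrom S h l)))) (EditDistance.ed≤EditsIn Data.Fin._≟_ edits)

  totalProbes≡0 : ∀ S t → totalProbes algorithm S t ≡ 0
  totalProbes≡0 S zero    = refl
  totalProbes≡0 S (suc t) = trans (+-identityʳ _) (totalProbes≡0 S t)

theorem3 : ∀ (c d : ℕ) → ∃[ C ] ∀ (n w σ : ℕ) → 1 ≤ w → σ ≤ d * n ^ c →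
    (F : Vec (Fin σ) n) → ∃[ Alg ]
      (∀ (S : ℕ → Fin σ) →
          (∀ i → IsOnlineAnswer (toList F) S i (output {w} {σ} Alg S i))
        × (∀ t → w * totalProbes Alg S t ≤ C * t * (w + ⌈log₂ n ⌉ ^ 2)))
theorem3 c d = 58 * (c + d + 1) , solution
  where
  solution : ∀ n w σ → 1 ≤ w → σ ≤ d * n ^ c → (F : Vec (Fin σ) n) → ∃[ Alg ]
    (∀ S → (∀ i → IsOnlineAnswer (toList F) S i (output {w} {σ} Alg S i))
         × (∀ t → w * totalProbes Alg S t ≤ 58 * (c + d + 1) * t * (w + ⌈log₂ n ⌉ ^ 2)))
  solution zero    w        σ _ _  [] = EmptyPattern.algorithm w σ , λ S →
    EmptyPattern.algorithm-correct w σ S ,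
    λ t → ≤-trans (≤-reflexive (trans (cong (w *_) (EmptyPattern.totalProbes≡0 w σ S t)) (*-zeroʳ w))) z≤n
  solution (suc n) (suc w′) σ _ σ≤ F  = Construction.algorithm c d n w′ σ σ≤ F , λ S →
    Construction.algorithm-correct c d n w′ σ σ≤ F S , Construction.algorithm-cost c d n w′ σ σ≤ F S
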